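{- Fix an adjacency type $t\in\{1,2,3,4\}$ and integers $1\le k\le n$. For every two irreducible (with respect to type $t$) permutations $\sigma,\tau$ of $\{0,1,\dots,k-1\}$, the number of permutations of $\{0,1,\dots,n-1\}$ whose reduced form (with respect to type $t$) equals $\sigma$ is the same as the number of permutations of $\{0,1,\dots,n-1\}$ whose reduced form equals $\tau$. That is, if some $\sigma\in P_k(0)$ is the reduced form of exactly $\mu$ permutations in $P_n$, then every $\sigma'\in P_k(0)$ is the reduced form of exactly $\mu$ permutations in $P_n$.
   Context: $P_m$ denotes the set of permutations of $\{0,1,\dots,m-1\}$, written as sequences $\pi=(\pi_1,\dots,\pi_m)$. Adjacency types: a type 1 adjacency is an index $i\in\{1,\dots,m-1\}$ with $\pi_{i+1}=\pi_i+1$. Type 2 adjacencies are the type 1 adjacencies plus one more if $\pi_m=m-1$. Type 3 adjacencies are the type 1 adjacencies plus one more if $\pi_1=0$. Type 4 adjacencies are the type 1 adjacencies plus one more if $\pi_m=m-1$ and one more if $\pi_1=0$. $P_m(j)$ is the set of permutations in $P_m$ with exactly $j$ adjacencies of the fixed type; a permutation is irreducible if it has no adjacencies, so $P_k(0)$ is the set of irreducible permutations of $\{0,\dots,k-1\}$. The reduced form of $\pi$ is obtained by repeating the following while an adjacency of the fixed type exists: if $\pi_{i+1}=\pi_i+1$ delete the entry $\pi_{i+1}$; (types 2, 4) if the last entry equals $m-1$, where $m$ is the current length, delete it; (types 3, 4) if the first entry is $0$, delete it; after each deletion, relabel the remaining entries by the unique order-preserving bijection onto $\{0,\dots,m-2\}$.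 Each deletion removes exactly one adjacency, the result is irreducible and does not depend on the order of deletions; a permutation in $P_n(n-k)$ has a reduced form in $P_k(0)$. -}

module Defs where

open import Data.Nat using (ℕ; zero; suc; _∸_; _<_; _≡ᵇ_; _<ᵇ_; _+_)
import Data.Nat as ℕ
open import Data.Bool using (Bool; true; false; if_then_else_)
open import Data.List using (List; []; _∷_; map; filter; length; upTo; concatMap; reverse)
open import Data.List.Properties using (≡-dec)
open import Data.List.Relation.Unary.Unique.Propositional using (Unique)
open import Data.List.Relation.Unary.Unique.DecPropositional ℕ._≟_ using (unique?)
open import Data.Maybe using (Maybe; just; nothing)
open import Data.Product using (_×_; _,_)
open import Relation.Binary.PropositionalEquality using (_≡_)
open import Data.List.Relation.Unary.All using (All)

data AdjType : Set where
  type1 type2 type3 type4 : AdjType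

-- Does the type count "last entry = m-1" / "first entry = 0" as an adjacency?
countsLast : AdjType → Bool
countsLast type2 = true
countsLast type4 = true
countsLast _     = false

countsFirst : AdjType → Bool
countsFirst type3 = true
countsFirst type4 = true
countsFirst _     = false

-- Permutations of {0,…,m-1}, written as sequences (lists) of length m.

words : ℕ → ℕ → List (List ℕ)
words m zero      = [] ∷ []
words m (suc len) = concatMap (λ x → map (x ∷_) (words m len)) (upTo m)

P : ℕ → List (List ℕ)
P m = filter unique? (words m m)

IsPerm : ℕ → List ℕ → Set
IsPerm m π = length π ≡ m × Unique π × All (_< m) π

b2n : Bool → ℕ
b2n true  = 1
b2n false = 0

adj1 : List ℕ → ℕ
adj1 (x ∷ y ∷ r) = b2n (y ≡ᵇ suc x) + adj1 (y ∷ r)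
adj1 _           = 0

lastIsMax : List ℕ → Bool
lastIsMax [] = false
lastIsMax π@(_ ∷ _) with reverse π
... | []    = false
... | y ∷ _ = y ≡ᵇ (length π ∸ 1)

firstIsZero : List ℕ → Bool
firstIsZero (x ∷ _) = x ≡ᵇ 0
firstIsZero []      = false

adj : AdjType → List ℕ → ℕ
adj t π = adj1 π
        + b2n (countsLast t Data.Bool.∧ lastIsMax π)
        + b2n (countsFirst t Data.Bool.∧ firstIsZero π)

relabel : ℕ → List ℕ → List ℕ
relabel v = map (λ x → if v <ᵇ x then x ∸ 1 else x)

-- find the first type 1 adjacency π_{i+1} = π_i + 1 and delete π_{i+1};
-- returns the deleted value and the remaining (not yet relabelled) list
delAdj1' : ℕ → List ℕ → Maybe (ℕ × List ℕ)
delAdj1' x []      = nothing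
delAdj1' x (y ∷ r) = if y ≡ᵇ suc x then just (y , x ∷ r) else consM (delAdj1' y r)
  where
  consM : Maybe (ℕ × List ℕ) → Maybe (ℕ × List ℕ)
  consM (just (v , r')) = just (v , x ∷ r')
  consM nothing         = nothing

delAdj1 : List ℕ → Maybe (ℕ × List ℕ)
delAdj1 []      = nothing
delAdj1 (x ∷ r) = delAdj1' x r

dropLast : List ℕ → List ℕ
dropLast []          = []
dropLast (x ∷ [])    = []
dropLast (x ∷ y ∷ r) = x ∷ dropLast (y ∷ r)

step : AdjType → List ℕ → Maybe (List ℕ)
step t π with delAdj1 π
... | just (v , π') = just (relabel v π')
... | nothing with countsLast t Data.Bool.∧ lastIsMax π
...   | true  = just (dropLast π)
...   | false with countsFirst t Data.Bool.∧ firstIsZero π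
...     | true  = just (relabel 0 (Data.List.drop 1 π))
...     | false = nothing

-- iterate with fuel (each step shortens the list, so length π steps suffice)
iter : AdjType → ℕ → List ℕ → List ℕ
iter t zero    π = π
iter t (suc f) π with step t π
... | just π' = iter t f π'
... | nothing = π

reduce : AdjType → List ℕ → List ℕ
reduce t π = iter t (length π) π

countRed : AdjType → ℕ → List ℕ → ℕ
countRed t n σ = length (filter (λ π → ≡-dec ℕ._≟_ (reduce t π) σ) (P n))

-- Framing turns every adjacency type into type 1: 'frame t π' puts a
-- new least entry in front (types 3, 4) and a new greatest entry at the end
-- (types 2, 4), and one reduction step of π is exactly the deletion of the
-- second entry of an adjacent pair w, w+1 of 'frame t π' followed by
-- relabelling ('contract').  Its inverse is 'expand', which re-inserts w+1
-- after w.  For an irreducible σ, whose frame σ̂ has no adjacent pair at all,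
-- running the reduction backwards shows:
--
--   π reduces to σ  ⇔  frame t π = inflate σ̂ c for some list c,
--
-- where 'inflate σ̂ c' replaces the i-th value of σ̂ by a run of c_i + 1
-- consecutive values.  The list c is unique, and it has length K = |σ̂| and
-- sum N - K where N = |frame t π|.  So the permutations reducing to σ are in
-- bijection with the weak compositions of N - K into K parts, a set that
-- depends on t, k and n only.
module Submission where

open import Defs
open import Data.Nat using (ℕ; zero; suc; _+_; _∸_; _≤_; _<_; s≤s; z≤n; _≡ᵇ_; _<ᵇ_; pred; _≟_; NonZero)
import Data.Nat.Properties as NP
open import Data.Bool using (Bool; true; false; T; _∧_; if_then_else_)
open import Data.List using (List; []; _∷_; _++_; map; length; filter; upTo; concatMap; reverse; drop; [_]; replicate)
open import Data.Nat.ListAction using (sum)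
open import Data.Nat.ListAction.Properties using (sum-↭)
import Data.List.Properties as LP
open import Data.List.Relation.Unary.All using (All; []; _∷_)
import Data.List.Relation.Unary.All as All
import Data.List.Relation.Unary.All.Properties as AP
open import Data.List.Relation.Unary.Any using (here; there)
import Data.List.Relation.Unary.Any as Any
open import Data.List.Membership.Propositional using (_∈_; _∉_)
open import Data.List.Membership.Propositional.Properties
  using (∈-++⁻; ∈-++⁺ˡ; ∈-++⁺ʳ; ∈-filter⁺; ∈-filter⁻; ∈-map⁺; ∈-map⁻; ∈-upTo⁺; ∈-upTo⁻)
open import Data.List.Membership.Propositional.Properties.WithK using (unique∧set⇒bag)
open import Data.List.Membership.DecPropositional _≟_ using (_∈?_)
open import Data.List.Relation.Unary.Unique.Propositional using (Unique)
import Data.List.Relation.Unary.Unique.Propositional.Properties as UP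
open import Data.List.Relation.Unary.Unique.DecPropositional _≟_ using (unique?)
open import Data.List.Relation.Unary.AllPairs using ([]; _∷_)
open import Data.List.Relation.Binary.BagAndSetEquality using (∼bag⇒↭)
open import Data.List.Relation.Binary.Permutation.Propositional using (_↭_)
import Data.List.Relation.Binary.Permutation.Propositional.Properties as PP
open import Data.Maybe using (just; nothing)
open import Data.Product using (∃; ∃₂; _×_; _,_; proj₁; proj₂)
open import Data.Sum using (_⊎_; inj₁; inj₂)
open import Data.Empty using (⊥; ⊥-elim)
open import Function using (case_of_)
open import Function.Bundles using (mk⇔)
open import Relation.Nullary using (¬_; Dec; yes; no)
open import Relation.Binary.Definitions using (tri<; tri≈; tri>)
open import Relation.Binary.PropositionalEquality hiding ([_])

≡ᵇ-refl : ∀ x → (x ≡ᵇ x) ≡ true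
≡ᵇ-refl zero = refl
≡ᵇ-refl (suc x) = ≡ᵇ-refl x

≡ᵇ-false : ∀ {x y} → x ≢ y → (x ≡ᵇ y) ≡ false
≡ᵇ-false {zero} {zero} ne = ⊥-elim (ne refl)
≡ᵇ-false {zero} {suc y} ne = refl
≡ᵇ-false {suc x} {zero} ne = refl
≡ᵇ-false {suc x} {suc y} ne = ≡ᵇ-false {x} {y} (λ e → ne (cong suc e))

≡ᵇ-true⇒ : ∀ {x y} → (x ≡ᵇ y) ≡ true → x ≡ y
≡ᵇ-true⇒ {x} {y} e = NP.≡ᵇ⇒≡ x y (subst T (sym e) _)

<ᵇ-true : ∀ {x y} → x < y → (x <ᵇ y) ≡ true
<ᵇ-true {x} {y} p with x <ᵇ y | NP.<⇒<ᵇ p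
... | true | _ = refl

<ᵇ-false : ∀ {x y} → y ≤ x → (x <ᵇ y) ≡ false
<ᵇ-false {x} {y} p with x <ᵇ y in eq
... | false = refl
... | true = ⊥-elim (NP.<⇒≱ (NP.<ᵇ⇒< x y (subst T (sym eq) _)) p)

b2n≡0⇒false : ∀ {b} → b2n b ≡ 0 → b ≡ false
b2n≡0⇒false {false} _ = refl

pred-pos : ∀ {x} → 0 < x → suc (pred x) ≡ x
pred-pos {suc x} _ = refl

pred-mono< : ∀ {u x m} → u < x → x < m → pred x < pred m
pred-mono< {x = suc x} {suc m} _ (s≤s p) = p

∈⇒≤sum : ∀ {x} c → x ∈ c → x ≤ sum c
∈⇒≤sum (y ∷ c) (here refl) = NP.m≤m+n y (sum c)
∈⇒≤sum (y ∷ c) (there p) = NP.≤-trans (∈⇒≤sum c p) (NP.m≤n+m (sum c) y)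

unique-++ˡ : ∀ {A B : List ℕ} → Unique (A ++ B) → Unique A
unique-++ˡ {[]} u = []
unique-++ˡ {a ∷ A} (p ∷ u) = AP.++⁻ˡ A p ∷ unique-++ˡ u

unique-++ʳ : ∀ {A B : List ℕ} → Unique (A ++ B) → Unique B
unique-++ʳ {[]} u = u
unique-++ʳ {a ∷ A} (_ ∷ u) = unique-++ʳ {A} u

unique-++-disjoint : ∀ {A B : List ℕ} {x} → Unique (A ++ B) → x ∈ A → x ∈ B → ⊥
unique-++-disjoint {a ∷ A} (p ∷ u) (here refl) xB = All.lookup (AP.++⁻ʳ A p) xB refl
unique-++-disjoint {a ∷ A} (p ∷ u) (there xA) xB = unique-++-disjoint u xA xB

unique-map-injectiveOn : ∀ {A B : Set} (f : A → B) xs → Unique xs →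
  (∀ {x y} → x ∈ xs → y ∈ xs → f x ≡ f y → x ≡ y) → Unique (map f xs)
unique-map-injectiveOn f [] _ _ = []
unique-map-injectiveOn f (x ∷ xs) (p ∷ u) inj =
  All.tabulate (λ {z} q e → let (y , yin , ez) = ∈-map⁻ f q in All.lookup p yin (inj (here refl) (there yin) (trans e ez)))
  ∷ unique-map-injectiveOn f xs u (λ a b → inj (there a) (there b))

same-elements⇒↭ : ∀ {A : Set} {xs ys : List A} → Unique xs → Unique ys →
  (∀ {x} → x ∈ xs → x ∈ ys) → (∀ {x} → x ∈ ys → x ∈ xs) → xs ↭ ys
same-elements⇒↭ ux uy f g = ∼bag⇒↭ (unique∧set⇒bag ux uy (λ {x} → mk⇔ f g))

same-elements⇒length : ∀ {A : Set} {xs ys : List A} → Unique xs → Unique ys →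
  (∀ {x} → x ∈ xs → x ∈ ys) → (∀ {x} → x ∈ ys → x ∈ xs) → length xs ≡ length ys
same-elements⇒length ux uy f g = PP.↭-length (same-elements⇒↭ ux uy f g)

range : ℕ → ℕ → List ℕ
range a zero = []
range a (suc l) = a ∷ range (suc a) l

range-∈⁻ : ∀ {x} a l → x ∈ range a l → a ≤ x × x < a + l
range-∈⁻ a (suc l) (here refl) = NP.≤-refl , NP.m<m+n a (s≤s z≤n)
range-∈⁻ {x} a (suc l) (there p) with range-∈⁻ (suc a) l p
... | p1 , p2 = NP.<⇒≤ p1 , subst (x <_) (sym (NP.+-suc a l)) p2

range-∈⁺ : ∀ {x} a l → a ≤ x → x < a + l → x ∈ range a l
range-∈⁺ {x} a zero p q = ⊥-elim (NP.<⇒≱ q (subst (_≤ x) (sym (NP.+-identityʳ a)) p))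
range-∈⁺ {x} a (suc l) p q with a ≟ x
... | yes refl = here refl
... | no ne = there (range-∈⁺ (suc a) l (NP.≤∧≢⇒< p ne) (subst (x <_) (NP.+-suc a l) q))

unique-range : ∀ a l → Unique (range a l)
unique-range a zero = []
unique-range a (suc l) = All.tabulate (λ {x} p e → NP.<⇒≢ (proj₁ (range-∈⁻ (suc a) l p)) e) ∷ unique-range (suc a) l

length-range : ∀ a l → length (range a l) ≡ l
length-range a zero = refl
length-range a (suc l) = cong suc (length-range (suc a) l)

range-snoc : ∀ a l → range a (suc l) ≡ range a l ++ [ a + l ]
range-snoc a zero = cong (λ z → z ∷ []) (sym (NP.+-identityʳ a))
range-snoc a (suc l) = cong (a ∷_) (trans (range-snoc (suc a) l) (cong (λ z → range (suc a) l ++ [ z ]) (sym (NP.+-suc a l))))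

range-+ : ∀ a m n → range a (m + n) ≡ range a m ++ range (a + m) n
range-+ a zero n = cong (λ z → range z n) (sym (NP.+-identityʳ a))
range-+ a (suc m) n = cong (a ∷_) (trans (range-+ (suc a) m n) (cong (λ z → range (suc a) m ++ range z n) (sym (NP.+-suc a m))))

-- A permutation of {0,…,K-1} contains every v < K (pigeonhole: the values
-- of range 0 K it contains already account for its whole length).
perm-covers : ∀ K s → Unique s → All (_< K) s → length s ≡ K → ∀ v → v < K → v ∈ s
perm-covers K s us as ls v v<K with v ∈? s
... | yes p = p
... | no np = ⊥-elim (NP.<⇒≢ lt (trans (sym ls') (trans ls (sym (length-range 0 K)))))
  where
  ys : List ℕ
  ys = filter (_∈? s) (range 0 K)
  ls' : length s ≡ length ys
  ls' = same-elements⇒length us (UP.filter⁺ (_∈? s) (unique-range 0 K))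
          (λ {x} p → ∈-filter⁺ (_∈? s) (range-∈⁺ 0 K z≤n (All.lookup as p)) p)
          (λ {x} p → proj₂ (∈-filter⁻ (_∈? s) {xs = range 0 K} p))
  lt : length ys < length (range 0 K)
  lt = LP.filter-notAll (_∈? s) (range 0 K)
         (Any.map (λ e p → np (subst (_∈ s) (sym e) p)) (range-∈⁺ 0 K z≤n v<K))

perm-↭ : ∀ {K s} → IsPerm K s → s ↭ range 0 K
perm-↭ {K} {s} (ls , us , as) = same-elements⇒↭ us (unique-range 0 K)
  (λ {x} p → range-∈⁺ 0 K z≤n (All.lookup as p))
  (λ {x} p → perm-covers K s us as ls x (proj₂ (range-∈⁻ 0 K p)))

data Consec (x y : ℕ) : List ℕ → Set where
  here  : ∀ {r} → Consec x y (x ∷ y ∷ r)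
  there : ∀ {z r} → Consec x y r → Consec x y (z ∷ r)

NoRise : List ℕ → Set
NoRise s = ∀ w → ¬ Consec w (suc w) s

consec-++⁻ : ∀ {x y} A B → Consec x y (A ++ B) →
  Consec x y A ⊎ Consec x y B ⊎ ((∃ λ A' → A ≡ A' ++ [ x ]) × (∃ λ B' → B ≡ y ∷ B'))
consec-++⁻ [] B p = inj₂ (inj₁ p)
consec-++⁻ (a ∷ []) (b ∷ B) here = inj₂ (inj₂ (([] , refl) , (B , refl)))
consec-++⁻ (a ∷ []) B (there p) = inj₂ (inj₁ p)
consec-++⁻ (a ∷ a' ∷ A) B here = inj₁ here
consec-++⁻ (a ∷ a' ∷ A) B (there p) with consec-++⁻ (a' ∷ A) B p
... | inj₁ q = inj₁ (there q)
... | inj₂ (inj₁ q) = inj₂ (inj₁ q)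
... | inj₂ (inj₂ ((A' , e) , r)) = inj₂ (inj₂ ((a ∷ A' , cong (a ∷_) e) , r))

consec-range⁻ : ∀ {x y} a l → Consec x y (range a l) → y ≡ suc x × a ≤ x × y < a + l
consec-range⁻ a (suc (suc l)) here =
  refl , NP.≤-refl , subst (suc a <_) (sym (NP.+-suc a (suc l))) (s≤s (NP.m<m+n a (s≤s z≤n)))
consec-range⁻ {x} {y} a (suc l) (there p) with consec-range⁻ (suc a) l p
... | e , q , r = e , NP.<⇒≤ q , subst (y <_) (sym (NP.+-suc a l)) r

consec-mem₁ : ∀ {x y L} → Consec x y L → x ∈ L
consec-mem₁ here = here refl
consec-mem₁ (there p) = there (consec-mem₁ p)

consec-mem₂ : ∀ {x y L} → Consec x y L → y ∈ L
consec-mem₂ here = there (here refl)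
consec-mem₂ (there p) = there (consec-mem₂ p)

consec-++ˡ : ∀ {x y} A B → Consec x y A → Consec x y (A ++ B)
consec-++ˡ (a ∷ b ∷ A) B here = here
consec-++ˡ (a ∷ A) B (there p) = there (consec-++ˡ A B p)

consec-mid : ∀ {x y} A B → Consec x y (A ++ x ∷ y ∷ B)
consec-mid [] B = here
consec-mid (a ∷ A) B = there (consec-mid A B)

consec-map-suc⁺ : ∀ {x y} L → Consec x y L → Consec (suc x) (suc y) (map suc L)
consec-map-suc⁺ (a ∷ b ∷ L) here = here
consec-map-suc⁺ (a ∷ L) (there p) = there (consec-map-suc⁺ L p)

consec-map-suc⁻ : ∀ {x y} L → Consec x y (map suc L) → ∃₂ λ x' y' → x ≡ suc x' × y ≡ suc y' × Consec x' y' L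
consec-map-suc⁻ (a ∷ b ∷ L) here = a , b , refl , refl , here
consec-map-suc⁻ (a ∷ L) (there p) with consec-map-suc⁻ L p
... | x' , y' , e1 , e2 , q = x' , y' , e1 , e2 , there q

consec-++ʳ : ∀ {x y} A B → Consec x y B → Consec x y (A ++ B)
consec-++ʳ [] B c = c
consec-++ʳ (a ∷ A) B c = there (consec-++ʳ A B c)

-- Deleting and re-inserting a value.  'contract u L' deletes the value u
-- from L and relabels the rest order-preservingly ('lower u' is the
-- relabelling used by 'relabel' in Defs); 'expand w L' is its inverse at an
-- adjacency: it shifts every value above w up by one and re-inserts w+1
-- directly after w.

shiftAbove : ℕ → ℕ → ℕ
shiftAbove w x = if w <ᵇ x then suc x else x

expand : ℕ → List ℕ → List ℕ
expand w [] = []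
expand w (x ∷ xs) = if x ≡ᵇ w then x ∷ suc x ∷ expand w xs else shiftAbove w x ∷ expand w xs

remove : ℕ → List ℕ → List ℕ
remove u [] = []
remove u (x ∷ xs) = if x ≡ᵇ u then remove u xs else x ∷ remove u xs

lower : ℕ → ℕ → ℕ
lower v x = if v <ᵇ x then x ∸ 1 else x

contract : ℕ → List ℕ → List ℕ
contract u L = relabel u (remove u L)

shiftAbove-≤ : ∀ {w x} → x ≤ w → shiftAbove w x ≡ x
shiftAbove-≤ {w} {x} p rewrite <ᵇ-false {w} {x} p = refl

shiftAbove-> : ∀ {w x} → w < x → shiftAbove w x ≡ suc x
shiftAbove-> {w} {x} p rewrite <ᵇ-true p = refl

lower-≤ : ∀ {v x} → x ≤ v → lower v x ≡ x
lower-≤ {v} {x} p rewrite <ᵇ-false {v} {x} p = refl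

lower-> : ∀ {v x} → v < x → lower v x ≡ pred x
lower-> {v} {x} p rewrite <ᵇ-true p = refl

expand-hit : ∀ w xs → expand w (w ∷ xs) ≡ w ∷ suc w ∷ expand w xs
expand-hit w xs rewrite ≡ᵇ-refl w = refl

expand-miss : ∀ {w x} xs → x ≢ w → expand w (x ∷ xs) ≡ shiftAbove w x ∷ expand w xs
expand-miss {w} {x} xs ne rewrite ≡ᵇ-false ne = refl

remove-hit : ∀ u xs → remove u (u ∷ xs) ≡ remove u xs
remove-hit u xs rewrite ≡ᵇ-refl u = refl

remove-miss : ∀ {u x} xs → x ≢ u → remove u (x ∷ xs) ≡ x ∷ remove u xs
remove-miss {u} {x} xs ne rewrite ≡ᵇ-false ne = refl

expand-++ : ∀ w A B → expand w (A ++ B) ≡ expand w A ++ expand w B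
expand-++ w [] B = refl
expand-++ w (x ∷ A) B with x ≡ᵇ w
... | true = cong (λ z → x ∷ suc x ∷ z) (expand-++ w A B)
... | false = cong (shiftAbove w x ∷_) (expand-++ w A B)

remove-++ : ∀ u A B → remove u (A ++ B) ≡ remove u A ++ remove u B
remove-++ u [] B = refl
remove-++ u (x ∷ A) B with x ≡ᵇ u
... | true = remove-++ u A B
... | false = cong (x ∷_) (remove-++ u A B)

contract-++ : ∀ u A B → contract u (A ++ B) ≡ contract u A ++ contract u B
contract-++ u A B rewrite remove-++ u A B = LP.map-++ (lower u) (remove u A) (remove u B)

contract-miss : ∀ {v x} xs → x ≢ v → contract v (x ∷ xs) ≡ lower v x ∷ contract v xs
contract-miss {v} {x} xs ne rewrite remove-miss {v} {x} xs ne = refl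

contract-hit : ∀ v xs → contract v (v ∷ xs) ≡ contract v xs
contract-hit v xs rewrite remove-hit v xs = refl

remove-∉ : ∀ u X → u ∉ X → remove u X ≡ X
remove-∉ u [] _ = refl
remove-∉ u (x ∷ X) nu rewrite remove-miss {u} {x} X (λ e → nu (here (sym e))) = cong (x ∷_) (remove-∉ u X (λ p → nu (there p)))

length-remove : ∀ u X → u ∈ X → Unique X → length (remove u X) ≡ pred (length X)
length-remove u (x ∷ X) (here refl) (p ∷ _) rewrite remove-hit u X | remove-∉ u X (λ q → All.lookup p q refl) = refl
length-remove u (x ∷ X) (there q) (p ∷ un) with x ≟ u
... | yes refl = ⊥-elim (All.lookup p q refl)
... | no ne rewrite remove-miss {u} {x} X ne | length-remove u X q un = NP.suc-pred (length X) ⦃ nz q ⦄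
  where nz : ∀ {X : List ℕ} → u ∈ X → NonZero (length X)
        nz (here _) = _
        nz (there _) = _

contract-below : ∀ u X → All (_< u) X → contract u X ≡ X
contract-below u [] _ = refl
contract-below u (x ∷ X) (p ∷ ps) rewrite contract-miss {u} {x} X (NP.<⇒≢ p) | lower-≤ {u} {x} (NP.<⇒≤ p)
  = cong (x ∷_) (contract-below u X ps)

-- Contraction commutes with shifting all values up by one (needed when
-- the frame prepends a new least entry).
lower-suc : ∀ u x → lower (suc u) (suc x) ≡ suc (lower u x)
lower-suc u x with NP.<-cmp u x
... | tri< lt _ _ rewrite lower-> {suc u} {suc x} (s≤s lt) | lower-> {u} {x} lt = sym (NP.suc-pred x ⦃ nz lt ⦄)
  where nz : ∀ {x} → u < x → NonZero x
        nz {suc x} _ = _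
... | tri≈ _ refl _ rewrite lower-≤ {suc u} {suc u} NP.≤-refl | lower-≤ {u} {u} NP.≤-refl = refl
... | tri> _ _ gt rewrite lower-≤ {suc u} {suc x} (s≤s (NP.<⇒≤ gt)) | lower-≤ {u} {x} (NP.<⇒≤ gt) = refl

remove-map-suc : ∀ u L → remove (suc u) (map suc L) ≡ map suc (remove u L)
remove-map-suc u [] = refl
remove-map-suc u (x ∷ L) with x ≟ u
... | yes refl rewrite remove-hit (suc x) (map suc L) | remove-hit x L = remove-map-suc x L
... | no ne rewrite remove-miss {suc u} {suc x} (map suc L) (λ e → ne (NP.suc-injective e)) | remove-miss {u} {x} L ne
  = cong (suc x ∷_) (remove-map-suc u L)

contract-map-suc : ∀ u L → contract (suc u) (map suc L) ≡ map suc (contract u L)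
contract-map-suc u L rewrite remove-map-suc u L = go (remove u L)
  where go : ∀ X → relabel (suc u) (map suc X) ≡ map suc (relabel u X)
        go [] = refl
        go (x ∷ X) = cong₂ _∷_ (lower-suc u x) (go X)

remove-∈⁻ : ∀ u L {x} → x ∈ remove u L → x ∈ L × x ≢ u
remove-∈⁻ u (y ∷ L) {x} q with y ≟ u
... | yes refl rewrite remove-hit y L = let (a , b) = remove-∈⁻ y L q in there a , b
... | no ne rewrite remove-miss {u} {y} L ne with q
...   | here refl = here refl , ne
...   | there q' = let (a , b) = remove-∈⁻ u L q' in there a , b

remove-∈⁺ : ∀ u L {x} → x ∈ L → x ≢ u → x ∈ remove u L
remove-∈⁺ u (y ∷ L) {x} q ne with y ≟ u
... | yes refl rewrite remove-hit y L with q
...   | here refl = ⊥-elim (ne refl)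
...   | there q' = remove-∈⁺ y L q' ne
remove-∈⁺ u (y ∷ L) {x} q ne | no ne' rewrite remove-miss {u} {y} L ne' with q
...   | here refl = here refl
...   | there q' = there (remove-∈⁺ u L q' ne)

unique-remove : ∀ u L → Unique L → Unique (remove u L)
unique-remove u [] _ = []
unique-remove u (y ∷ L) (p ∷ un) with y ≟ u
... | yes refl rewrite remove-hit y L = unique-remove y L un
... | no ne rewrite remove-miss {u} {y} L ne = All.tabulate (λ q → All.lookup p (proj₁ (remove-∈⁻ u L q))) ∷ unique-remove u L un

lower-injective : ∀ {u x y} → x ≢ u → y ≢ u → lower u x ≡ lower u y → x ≡ y
lower-injective {u} {x} {y} nx ny e with NP.<-cmp x u | NP.<-cmp y u
... | tri< a _ _ | tri< b _ _ rewrite lower-≤ {u} {x} (NP.<⇒≤ a) | lower-≤ {u} {y} (NP.<⇒≤ b) = e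
... | tri< a _ _ | tri> _ _ b rewrite lower-≤ {u} {x} (NP.<⇒≤ a) | lower-> {u} {y} b =
      ⊥-elim (NP.<⇒≱ a (NP.≤-pred (subst (suc u ≤_) (sym (trans (cong suc e) (pred-pos (NP.≤-trans (s≤s z≤n) b)))) b)))
... | tri> _ _ a | tri< b _ _ rewrite lower-> {u} {x} a | lower-≤ {u} {y} (NP.<⇒≤ b) =
      ⊥-elim (NP.<⇒≱ b (NP.≤-pred (subst (suc u ≤_) (trans (sym (pred-pos (NP.≤-trans (s≤s z≤n) a))) (cong suc e)) a)))
... | tri> _ _ a | tri> _ _ b rewrite lower-> {u} {x} a | lower-> {u} {y} b =
      trans (sym (pred-pos (NP.≤-trans (s≤s z≤n) a))) (trans (cong suc e) (pred-pos (NP.≤-trans (s≤s z≤n) b)))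
... | tri≈ _ a _ | _ = ⊥-elim (nx a)
... | _ | tri≈ _ b _ = ⊥-elim (ny b)

contract-perm : ∀ {m L u} → IsPerm m L → u ∈ L → IsPerm (pred m) (contract u L)
contract-perm {m} {L} {u} (l , un , a) uL =
  trans (LP.length-map (lower u) (remove u L)) (trans (length-remove u L uL un) (cong pred l)) ,
  unique-map-injectiveOn (lower u) (remove u L) (unique-remove u L un)
    (λ p q e → lower-injective (proj₂ (remove-∈⁻ u L p)) (proj₂ (remove-∈⁻ u L q)) e) ,
  AP.map⁺ (All.tabulate λ {x} q → bound x (remove-∈⁻ u L q))
  where
  u<m : u < m
  u<m = All.lookup a uL
  bound : ∀ x → x ∈ L × x ≢ u → lower u x < pred m
  bound x (xL , ne) with NP.<-cmp x u
  ... | tri< lt _ _ rewrite lower-≤ {u} {x} (NP.<⇒≤ lt) = NP.<-≤-trans lt (NP.<⇒≤pred u<m)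
  ... | tri≈ _ e _ = ⊥-elim (ne e)
  ... | tri> _ _ gt rewrite lower-> {u} {x} gt = pred-mono< gt (All.lookup a xL)

contract-∈⁺ : ∀ u L {x} → x ∈ L → x ≢ u → lower u x ∈ contract u L
contract-∈⁺ u L q ne = ∈-map⁺ (lower u) (remove-∈⁺ u L q ne)

consec-∈-contract : ∀ {w L} → Consec w (suc w) L → w ∈ contract (suc w) L
consec-∈-contract {w} {L} rise = subst (_∈ contract (suc w) L) (lower-≤ (NP.n≤1+n w))
  (contract-∈⁺ (suc w) L (consec-mem₁ rise) (λ e → NP.1+n≢n (sym e)))

-- Deleting the second entry of an adjacent pair w, w+1 and relabelling,
-- the case shape produced by the deletion step of Defs.
contract-adjacent : ∀ A w B → Unique (A ++ w ∷ suc w ∷ B) → contract (suc w) (A ++ w ∷ suc w ∷ B) ≡ relabel (suc w) (A ++ w ∷ B)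
contract-adjacent A w B u = cong (relabel (suc w)) (trans (remove-++ (suc w) A _) (cong₂ _++_ (remove-∉ (suc w) A nA) rest))
  where
  nA : suc w ∉ A
  nA q = unique-++-disjoint u q (there (here refl))
  nB : suc w ∉ B
  nB with unique-++ʳ {A} u
  ... | _ ∷ (p ∷ _) = λ q → All.lookup p q refl
  rest : remove (suc w) (w ∷ suc w ∷ B) ≡ w ∷ B
  rest rewrite remove-miss {suc w} {w} (suc w ∷ B) (λ e → NP.1+n≢n (sym e)) | remove-hit (suc w) B = cong (w ∷_) (remove-∉ (suc w) B nB)
expand-lower : ∀ w x X → x ≢ w → x ≢ suc w → expand w (lower (suc w) x ∷ X) ≡ x ∷ expand w X
expand-lower w x X n1 n2 with NP.<-cmp x (suc w)
... | tri< lt _ _ rewrite lower-≤ {suc w} {x} (NP.<⇒≤ lt) | expand-miss {w} {x} X n1 | shiftAbove-≤ {w} {x} (NP.≤-pred lt) = refl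
... | tri≈ _ e _ = ⊥-elim (n2 e)
... | tri> _ _ gt rewrite lower-> {suc w} {x} gt
  | expand-miss {w} {pred x} X (λ e → n2 (trans (sym (pred-pos (NP.≤-trans (s≤s z≤n) gt))) (cong suc e)))
  | shiftAbove-> {w} {pred x} (NP.≤-pred (subst (suc (suc w) ≤_) (sym (pred-pos (NP.≤-trans (s≤s z≤n) gt))) gt))
  = cong (_∷ expand w X) (pred-pos (NP.≤-trans (s≤s z≤n) gt))

expand-contract-∉ : ∀ w r → w ∉ r → suc w ∉ r → expand w (contract (suc w) r) ≡ r
expand-contract-∉ w [] _ _ = refl
expand-contract-∉ w (x ∷ r) n1 n2
  rewrite contract-miss {suc w} {x} r (λ e → n2 (here (sym e)))
  = trans (expand-lower w x (contract (suc w) r) (λ e → n1 (here (sym e))) (λ e → n2 (here (sym e))))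
          (cong (x ∷_) (expand-contract-∉ w r (λ q → n1 (there q)) (λ q → n2 (there q))))

expand-contract : ∀ w L → Unique L → Consec w (suc w) L → expand w (contract (suc w) L) ≡ L
expand-contract w (.w ∷ .(suc w) ∷ r) (p ∷ (p' ∷ un)) here
  rewrite contract-miss {suc w} {w} (suc w ∷ r) (λ e → NP.1+n≢n (sym e)) | lower-≤ {suc w} {w} (NP.n≤1+n w)
        | contract-hit (suc w) r | expand-hit w (contract (suc w) r)
  = cong (λ z → w ∷ suc w ∷ z) (expand-contract-∉ w r (λ q → All.lookup p (there q) refl) (λ q → All.lookup p' q refl))
expand-contract w (x ∷ L) (p ∷ un) (there c)
  rewrite contract-miss {suc w} {x} L (λ e → All.lookup p (consec-mem₂ c) e)
  = trans (expand-lower w x (contract (suc w) L) (λ e → All.lookup p (consec-mem₁ c) e) (λ e → All.lookup p (consec-mem₂ c) e))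
          (cong (x ∷_) (expand-contract w L un c))

expand-range-below : ∀ w a l → a + l ≤ w → expand w (range a l) ≡ range a l
expand-range-below w a zero p = refl
expand-range-below w a (suc l) p
  rewrite expand-miss {w} {a} (range (suc a) l) (λ e → NP.<⇒≢ (NP.<-≤-trans (NP.m<m+n a (s≤s z≤n)) p) e)
        | shiftAbove-≤ {w} {a} (NP.<⇒≤ (NP.<-≤-trans (NP.m<m+n a (s≤s z≤n)) p))
  = cong (a ∷_) (expand-range-below w (suc a) l (subst (_≤ w) (NP.+-suc a l) p))

expand-range-above : ∀ w a l → w < a → expand w (range a l) ≡ range (suc a) l
expand-range-above w a zero p = refl
expand-range-above w a (suc l) p
  rewrite expand-miss {w} {a} (range (suc a) l) (λ e → NP.<⇒≢ p (sym e))
        | shiftAbove-> {w} {a} p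
  = cong (suc a ∷_) (expand-range-above w (suc a) l (NP.m<n⇒m<1+n p))

expand-range-inside : ∀ w a l → a ≤ w → w < a + l → expand w (range a l) ≡ range a (suc l)
expand-range-inside w a zero p q = ⊥-elim (NP.<⇒≱ q (subst (_≤ w) (sym (NP.+-identityʳ a)) p))
expand-range-inside w a (suc l) p q with a ≟ w
... | yes refl rewrite expand-hit a (range (suc a) l) = cong (λ z → a ∷ suc a ∷ z) (expand-range-above a (suc a) l NP.≤-refl)
... | no ne rewrite expand-miss {w} {a} (range (suc a) l) ne | shiftAbove-≤ {w} {a} p
  = cong (a ∷_) (expand-range-inside w (suc a) l (NP.≤∧≢⇒< p ne) (subst (w <_) (NP.+-suc a l) q))

contract-range-below : ∀ v a l → a + l ≤ v → contract v (range a l) ≡ range a l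
contract-range-below v a zero p = refl
contract-range-below v a (suc l) p
  rewrite contract-miss {v} {a} (range (suc a) l) (λ e → NP.<⇒≢ (NP.<-≤-trans (NP.m<m+n a (s≤s z≤n)) p) e)
        | lower-≤ {v} {a} (NP.<⇒≤ (NP.<-≤-trans (NP.m<m+n a (s≤s z≤n)) p))
  = cong (a ∷_) (contract-range-below v (suc a) l (subst (_≤ v) (NP.+-suc a l) p))

contract-range-above : ∀ v a l → v ≤ a → contract v (range (suc a) l) ≡ range a l
contract-range-above v a zero p = refl
contract-range-above v a (suc l) p
  rewrite contract-miss {v} {suc a} (range (suc (suc a)) l) (λ e → NP.<⇒≢ (s≤s p) (sym e))
        | lower-> {v} {suc a} (s≤s p)
  = cong (a ∷_) (contract-range-above v (suc a) l (NP.m≤n⇒m≤1+n p))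

contract-range-inside : ∀ v a l → a < v → v ≤ a + l → contract v (range a (suc l)) ≡ range a l
contract-range-inside v a zero p q = ⊥-elim (NP.<⇒≱ p (subst (v ≤_) (NP.+-identityʳ a) q))
contract-range-inside v a (suc l) p q
  rewrite contract-miss {v} {a} (range (suc a) (suc l)) (λ e → NP.<⇒≢ p e)
        | lower-≤ {v} {a} (NP.<⇒≤ p)
  with suc a ≟ v
... | yes refl rewrite contract-hit (suc a) (range (suc (suc a)) l) = cong (a ∷_) (contract-range-above (suc a) (suc a) l NP.≤-refl)
... | no ne = cong (a ∷_) (contract-range-inside v (suc a) l (NP.≤∧≢⇒< p ne) (subst (v ≤_) (NP.+-suc a l) q))

-- For a list c of block sizes ('c ! v' reads entry v, with 0
-- out of range), value v is replaced by the run 'block c v' of c_v + 1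
-- consecutive values starting at 'offset c v' = Σ_{u<v} (c_u + 1).
-- Thus 'inflate s c' is the permutation that reduces to s by collapsing
-- each block, and 'incAt u c' / 'decAt u c' grow / shrink block u.

_!_ : List ℕ → ℕ → ℕ
[] ! v = 0
(x ∷ xs) ! zero = x
(x ∷ xs) ! suc v = xs ! v

offset : List ℕ → ℕ → ℕ
offset c zero = 0
offset c (suc v) = offset c v + suc (c ! v)

block : List ℕ → ℕ → List ℕ
block c v = range (offset c v) (suc (c ! v))

inflate : List ℕ → List ℕ → List ℕ
inflate [] c = []
inflate (v ∷ s) c = block c v ++ inflate s c

incAt : ℕ → List ℕ → List ℕ
incAt u [] = []
incAt zero (x ∷ xs) = suc x ∷ xs
incAt (suc u) (x ∷ xs) = x ∷ incAt u xs

decAt : ℕ → List ℕ → List ℕ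
decAt u [] = []
decAt zero (x ∷ xs) = pred x ∷ xs
decAt (suc u) (x ∷ xs) = x ∷ decAt u xs

offset<suc : ∀ c v → offset c v < offset c (suc v)
offset<suc c v = NP.m<m+n (offset c v) (s≤s z≤n)

offset-mono : ∀ c {v v'} → v ≤ v' → offset c v ≤ offset c v'
offset-mono c {v} {zero} z≤n = NP.≤-refl
offset-mono c {v} {suc v'} p with v ≟ suc v'
... | yes refl = NP.≤-refl
... | no ne = NP.≤-trans (offset-mono c {v} {v'} (NP.≤-pred (NP.≤∧≢⇒< p ne))) (NP.<⇒≤ (offset<suc c v'))

offset-injective : ∀ c {v v'} → offset c v ≡ offset c v' → v ≡ v'
offset-injective c {v} {v'} e with NP.<-cmp v v'
... | tri< lt _ _ = ⊥-elim (NP.<⇒≢ (NP.<-≤-trans (offset<suc c v) (offset-mono c lt)) e)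
... | tri≈ _ eq _ = eq
... | tri> _ _ gt = ⊥-elim (NP.<⇒≢ (NP.<-≤-trans (offset<suc c v') (offset-mono c gt)) (sym e))

!-incAt-same : ∀ u c → u < length c → incAt u c ! u ≡ suc (c ! u)
!-incAt-same zero (x ∷ c) p = refl
!-incAt-same (suc u) (x ∷ c) (s≤s p) = !-incAt-same u c p

!-incAt-other : ∀ u c v → v ≢ u → incAt u c ! v ≡ c ! v
!-incAt-other u [] v ne = refl
!-incAt-other zero (x ∷ c) zero ne = ⊥-elim (ne refl)
!-incAt-other zero (x ∷ c) (suc v) ne = refl
!-incAt-other (suc u) (x ∷ c) zero ne = refl
!-incAt-other (suc u) (x ∷ c) (suc v) ne = !-incAt-other u c v (λ e → ne (cong suc e))

offset-incAt-≤ : ∀ u c v → v ≤ u → offset (incAt u c) v ≡ offset c v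
offset-incAt-≤ u c zero p = refl
offset-incAt-≤ u c (suc v) p
  rewrite offset-incAt-≤ u c v (NP.<⇒≤ p) | !-incAt-other u c v (λ e → NP.<⇒≢ p e) = refl

offset-incAt-> : ∀ u c v → u < v → u < length c → offset (incAt u c) v ≡ suc (offset c v)
offset-incAt-> u c (suc v) (s≤s p) q with u ≟ v
... | yes refl rewrite offset-incAt-≤ u c u NP.≤-refl | !-incAt-same u c q = NP.+-suc (offset c u) (suc (c ! u))
... | no ne rewrite offset-incAt-> u c v (NP.≤∧≢⇒< p ne) q | !-incAt-other u c v (λ e → ne (sym e)) = refl

length-incAt : ∀ u c → length (incAt u c) ≡ length c
length-incAt u [] = refl
length-incAt zero (x ∷ c) = refl
length-incAt (suc u) (x ∷ c) = cong suc (length-incAt u c)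

length-decAt : ∀ u c → length (decAt u c) ≡ length c
length-decAt u [] = refl
length-decAt zero (x ∷ c) = refl
length-decAt (suc u) (x ∷ c) = cong suc (length-decAt u c)

incAt-decAt : ∀ u c → u < length c → 1 ≤ c ! u → incAt u (decAt u c) ≡ c
incAt-decAt zero (suc x ∷ c) p q = refl
incAt-decAt (suc u) (x ∷ c) (s≤s p) q = cong (x ∷_) (incAt-decAt u c p q)

sum-incAt : ∀ u c → u < length c → sum (incAt u c) ≡ suc (sum c)
sum-incAt zero (x ∷ c) p = refl
sum-incAt (suc u) (x ∷ c) (s≤s p) rewrite sum-incAt u c p = NP.+-suc x (sum c)

expand-inflate : ∀ s c w u → offset c u ≤ w → w < offset c (suc u) → u < length c →
           expand w (inflate s c) ≡ inflate s (incAt u c)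
expand-inflate [] c w u p q r = refl
expand-inflate (v ∷ s) c w u p q r = trans (expand-++ w (block c v) (inflate s c)) (cong₂ _++_ dblk (expand-inflate s c w u p q r))
  where
  dblk : expand w (block c v) ≡ block (incAt u c) v
  dblk with NP.<-cmp v u
  ... | tri< lt _ _ rewrite offset-incAt-≤ u c v (NP.<⇒≤ lt) | !-incAt-other u c v (λ e → NP.<⇒≢ lt e)
    = expand-range-below w (offset c v) (suc (c ! v)) (NP.≤-trans (offset-mono c lt) p)
  ... | tri≈ _ refl _ rewrite offset-incAt-≤ v c v NP.≤-refl | !-incAt-same v c r
    = expand-range-inside w (offset c v) (suc (c ! v)) p q
  ... | tri> _ _ gt rewrite offset-incAt-> u c v gt r | !-incAt-other u c v (λ e → NP.<⇒≢ gt (sym e))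
    = expand-range-above w (offset c v) (suc (c ! v)) (NP.<-≤-trans q (offset-mono c gt))

contract-inflate : ∀ s d v u → offset d u < v → v ≤ offset d (suc u) → u < length d →
             contract v (inflate s (incAt u d)) ≡ inflate s d
contract-inflate [] d v u p q r = refl
contract-inflate (v' ∷ s) d v u p q r =
  trans (contract-++ v (block (incAt u d) v') (inflate s (incAt u d))) (cong₂ _++_ ublk (contract-inflate s d v u p q r))
  where
  ublk : contract v (block (incAt u d) v') ≡ block d v'
  ublk with NP.<-cmp v' u
  ... | tri< lt _ _ rewrite offset-incAt-≤ u d v' (NP.<⇒≤ lt) | !-incAt-other u d v' (λ e → NP.<⇒≢ lt e)
    = contract-range-below v (offset d v') (suc (d ! v')) (NP.<⇒≤ (NP.≤-<-trans (offset-mono d lt) p))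
  ... | tri≈ _ refl _ rewrite offset-incAt-≤ v' d v' NP.≤-refl | !-incAt-same v' d r
    = contract-range-inside v (offset d v') (suc (d ! v')) p q
  ... | tri> _ _ gt rewrite offset-incAt-> u d v' gt r | !-incAt-other u d v' (λ e → NP.<⇒≢ gt (sym e))
    = contract-range-above v (offset d v') (suc (d ! v')) (NP.≤-trans q (offset-mono d gt))

inflate-∈⁻ : ∀ s c {w} → w ∈ inflate s c → ∃ λ u → u ∈ s × offset c u ≤ w × w < offset c (suc u)
inflate-∈⁻ (v ∷ s) c {w} p with ∈-++⁻ (block c v) p
... | inj₁ q = v , here refl , range-∈⁻ (offset c v) (suc (c ! v)) q
... | inj₂ q with inflate-∈⁻ s c q
...   | u , us , r = u , there us , r

-- If s has no rise, an adjacent pair w, w+1 of 'inflate s c' lies inside a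
-- single block: across the seam of the blocks of v and v' it would force
-- v' = v + 1.
consec-inflate⁻ : ∀ s c {w} → NoRise s → Consec w (suc w) (inflate s c) →
  ∃ λ u → u ∈ s × offset c u ≤ w × suc w < offset c (suc u)
consec-inflate⁻ (v ∷ s) c {w} irr p with consec-++⁻ (block c v) (inflate s c) p
... | inj₁ q with consec-range⁻ (offset c v) (suc (c ! v)) q
...   | _ , q1 , q2 = v , here refl , q1 , q2
consec-inflate⁻ (v ∷ s) c {w} irr p | inj₂ (inj₁ q) with consec-inflate⁻ s c (λ w' r → irr w' (there r)) q
...   | u , us , r = u , there us , r
consec-inflate⁻ (v ∷ [])      c {w} irr p | inj₂ (inj₂ (_ , (B' , ())))
consec-inflate⁻ (v ∷ v' ∷ s) c {w} irr p | inj₂ (inj₂ ((A' , e1) , (B' , e2))) =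
  ⊥-elim (irr v (subst (λ z → Consec v z (v ∷ v' ∷ s)) v'≡ here))
  where
  lastw : w ≡ offset c v + c ! v
  lastw = sym (LP.∷ʳ-injectiveʳ (range (offset c v) (c ! v)) A' (trans (sym (range-snoc (offset c v) (c ! v))) e1))
  headv' : offset c v' ≡ suc w
  headv' = proj₁ (LP.∷-injective e2)
  v'≡ : v' ≡ suc v
  v'≡ = offset-injective c (trans headv' (trans (cong suc lastw) (sym (NP.+-suc (offset c v) (c ! v)))))

consec-inflate-block : ∀ s c u → u ∈ s → 0 < c ! u → Consec (offset c u) (suc (offset c u)) (inflate s c)
consec-inflate-block (v ∷ s) c u (here refl) p = consec-++ˡ (block c u) (inflate s c) (cb (c ! u) p)
  where cb : ∀ j → 0 < j → Consec (offset c u) (suc (offset c u)) (range (offset c u) (suc j))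
        cb (suc j) _ = here
consec-inflate-block (v ∷ s) c u (there q) p = consec-++ʳ (block c v) (inflate s c) (consec-inflate-block s c u q p)

replicate-! : ∀ K u → replicate K 0 ! u ≡ 0
replicate-! zero u = refl
replicate-! (suc K) zero = refl
replicate-! (suc K) (suc u) = replicate-! K u

sum≡0⇒!≡0 : ∀ c → sum c ≡ 0 → ∀ u → c ! u ≡ 0
sum≡0⇒!≡0 [] e u = refl
sum≡0⇒!≡0 (x ∷ c) e zero = NP.m+n≡0⇒m≡0 x e
sum≡0⇒!≡0 (x ∷ c) e (suc u) = sum≡0⇒!≡0 c (NP.m+n≡0⇒n≡0 x e) u

sum≢0⇒positive-entry : ∀ c → sum c ≢ 0 → ∃ λ u → u < length c × 0 < c ! u
sum≢0⇒positive-entry [] ne = ⊥-elim (ne refl)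
sum≢0⇒positive-entry (zero ∷ c) ne with sum≢0⇒positive-entry c ne
... | u , p , q = suc u , s≤s p , q
sum≢0⇒positive-entry (suc x ∷ c) ne = 0 , s≤s z≤n , s≤s z≤n

blockSize : List ℕ → ℕ → ℕ
blockSize c v = suc (c ! v)

length-inflate : ∀ s c → length (inflate s c) ≡ sum (map (blockSize c) s)
length-inflate [] c = refl
length-inflate (v ∷ s) c = trans (LP.length-++ (block c v))
  (cong₂ _+_ (length-range (offset c v) (suc (c ! v))) (length-inflate s c))

sum-blockSize-range : ∀ c a m → sum (map (blockSize c) (range a m)) + offset c a ≡ offset c (a + m)
sum-blockSize-range c a zero = cong (offset c) (sym (NP.+-identityʳ a))
sum-blockSize-range c a (suc m) = begin
    (suc (c ! a) + S) + offset c a   ≡⟨ NP.+-comm (suc (c ! a) + S) (offset c a) ⟩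
    offset c a + (suc (c ! a) + S)   ≡⟨ sym (NP.+-assoc (offset c a) (suc (c ! a)) S) ⟩
    offset c (suc a) + S             ≡⟨ NP.+-comm (offset c (suc a)) S ⟩
    S + offset c (suc a)             ≡⟨ sum-blockSize-range c (suc a) m ⟩
    offset c (suc a + m)             ≡⟨ cong (offset c) (sym (NP.+-suc a m)) ⟩
    offset c (a + suc m)             ∎
  where open ≡-Reasoning
        S : ℕ
        S = sum (map (blockSize c) (range (suc a) m))

length-inflate-perm : ∀ {K s} c → IsPerm K s → length (inflate s c) ≡ offset c K
length-inflate-perm {K} {s} c ps = begin
  length (inflate s c)                    ≡⟨ length-inflate s c ⟩
  sum (map (blockSize c) s)                  ≡⟨ sum-↭ (PP.map⁺ (blockSize c) (perm-↭ ps)) ⟩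
  sum (map (blockSize c) (range 0 K))        ≡⟨ sym (NP.+-identityʳ _) ⟩
  sum (map (blockSize c) (range 0 K)) + 0    ≡⟨ sum-blockSize-range c 0 K ⟩
  offset c K                              ∎
  where open ≡-Reasoning

offset-∷ : ∀ x c v → offset (x ∷ c) (suc v) ≡ suc x + offset c v
offset-∷ x c zero = sym (NP.+-identityʳ (suc x))
offset-∷ x c (suc v) rewrite offset-∷ x c v = NP.+-assoc (suc x) (offset c v) (suc (c ! v))

offset-length : ∀ c → offset c (length c) ≡ length c + sum c
offset-length [] = refl
offset-length (x ∷ c) rewrite offset-∷ x c (length c) | offset-length c = cong suc (begin
    x + (length c + sum c)  ≡⟨ sym (NP.+-assoc x (length c) (sum c)) ⟩
    (x + length c) + sum c  ≡⟨ cong (_+ sum c) (NP.+-comm x (length c)) ⟩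
    (length c + x) + sum c  ≡⟨ NP.+-assoc (length c) x (sum c) ⟩
    length c + (x + sum c)  ∎)
  where open ≡-Reasoning

offset-zeros : ∀ c → (∀ u → c ! u ≡ 0) → ∀ v → offset c v ≡ v
offset-zeros c z zero = refl
offset-zeros c z (suc v) rewrite offset-zeros c z v | z v = NP.+-comm v 1

inflate-zeros : ∀ s c → (∀ u → c ! u ≡ 0) → inflate s c ≡ s
inflate-zeros [] c z = refl
inflate-zeros (v ∷ s) c z rewrite offset-zeros c z v | z v = cong (v ∷_) (inflate-zeros s c z)

length-inflate-≥ : ∀ s c → length s ≤ length (inflate s c)
length-inflate-≥ [] c = z≤n
length-inflate-≥ (v ∷ s) c = s≤s (NP.≤-trans (length-inflate-≥ s c) (NP.≤-trans (NP.m≤n+m _ (length (range (suc (offset c v)) (c ! v))))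
  (NP.≤-reflexive (sym (LP.length-++ (range (suc (offset c v)) (c ! v)))))))

blocks-disjoint : ∀ c {u v x} → u ≢ v → offset c u ≤ x → x < offset c (suc u) → offset c v ≤ x → x < offset c (suc v) → ⊥
blocks-disjoint c {u} {v} ne p1 p2 q1 q2 with NP.<-cmp u v
... | tri< lt _ _ = NP.<⇒≱ p2 (NP.≤-trans (offset-mono c lt) q1)
... | tri≈ _ e _ = ne e
... | tri> _ _ gt = NP.<⇒≱ q2 (NP.≤-trans (offset-mono c gt) p1)

unique-inflate : ∀ s c → Unique s → Unique (inflate s c)
unique-inflate [] c us = []
unique-inflate (v ∷ s) c (vs ∷ us) = UP.++⁺ (unique-range (offset c v) (suc (c ! v))) (unique-inflate s c us) disj
  where
  disj : ∀ {x} → ¬ (x ∈ block c v × x ∈ inflate s c)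
  disj (p , q) with range-∈⁻ (offset c v) (suc (c ! v)) p | inflate-∈⁻ s c q
  ... | p1 , p2 | u , us' , q1 , q2 =
    blocks-disjoint c {v} {u} (λ e → All.lookup vs us' e) p1 p2 q1 q2

inflate-bounded : ∀ K s c → All (_< K) s → All (_< offset c K) (inflate s c)
inflate-bounded K s c as = All.tabulate λ {x} p → let (u , us , q1 , q2) = inflate-∈⁻ s c p in
  NP.<-≤-trans q2 (offset-mono c (All.lookup as us))

inflate-perm : ∀ {K s} c → IsPerm K s → IsPerm (offset c K) (inflate s c)
inflate-perm {K} {s} c ps@(ls , us , as) = length-inflate-perm c ps , unique-inflate s c us , inflate-bounded K s c as

-- Inflation of a rise-free s is injective in c: if two inflations agreed
-- but block v were longer in one of them, the longer block would run into
-- the first value of the next block, forcing a rise v, v+1 in s.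
inflate-no-overlong-block : ∀ v s c {X Y} → NoRise (v ∷ s) → X ≡ inflate s c →
   ∀ δ → block c v ++ X ≡ range (offset c v) (suc (c ! v) + suc δ) ++ Y → ⊥
inflate-no-overlong-block v s c {X} {Y} irr eX δ e = go s irr (trans (sym e'') eX)
  where
  e' : range (offset c v) (suc (c ! v) + suc δ) ++ Y ≡ block c v ++ (range (offset c v + suc (c ! v)) (suc δ) ++ Y)
  e' = trans (cong (_++ Y) (range-+ (offset c v) (suc (c ! v)) (suc δ)))
             (LP.++-assoc (block c v) (range (offset c v + suc (c ! v)) (suc δ)) Y)
  e'' : X ≡ range (offset c v + suc (c ! v)) (suc δ) ++ Y
  e'' = LP.++-cancelˡ (block c v) X _ (trans e e')
  go : ∀ s → NoRise (v ∷ s) → range (offset c v + suc (c ! v)) (suc δ) ++ Y ≡ inflate s c → ⊥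
  go [] irr ()
  go (v' ∷ s') irr q = irr v (subst (λ z → Consec v z (v ∷ v' ∷ s')) (offset-injective c (sym (proj₁ (LP.∷-injective q)))) here)

inflate-injective-on : ∀ s c d → NoRise s → inflate s c ≡ inflate s d → All (λ v → c ! v ≡ d ! v) s
inflate-injective-on [] c d irr e = []
inflate-injective-on (v ∷ s) c d irr e with LP.∷-injective e
... | hd , _ with NP.<-cmp (c ! v) (d ! v)
...   | tri≈ _ eq _ = eq ∷ inflate-injective-on s c d (λ w r → irr w (there r))
          (LP.++-cancelˡ (block c v) (inflate s c) (inflate s d) (trans e (cong₂ (λ a b → range a (suc b) ++ inflate s d) (sym hd) (sym eq))))
...   | tri< lt _ _ = ⊥-elim (inflate-no-overlong-block v s c irr refl δ (trans e
          (cong₂ (λ a b → range a b ++ inflate s d) (sym hd) dd)))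
  where
  δ : ℕ
  δ = d ! v ∸ suc (c ! v)
  dd : suc (d ! v) ≡ suc (c ! v) + suc δ
  dd = cong suc (trans (sym (NP.m+[n∸m]≡n lt)) (sym (NP.+-suc (c ! v) δ)))
...   | tri> _ _ gt = ⊥-elim (inflate-no-overlong-block v s d irr refl δ (trans (sym e)
          (cong₂ (λ a b → range a b ++ inflate s c) hd dd)))
  where
  δ : ℕ
  δ = c ! v ∸ suc (d ! v)
  dd : suc (c ! v) ≡ suc (d ! v) + suc δ
  dd = cong suc (trans (sym (NP.m+[n∸m]≡n gt)) (sym (NP.+-suc (d ! v) δ)))

!-extensional : ∀ c d → length c ≡ length d → (∀ v → v < length c → c ! v ≡ d ! v) → c ≡ d
!-extensional [] [] _ _ = refl
!-extensional (x ∷ c) (y ∷ d) l f = cong₂ _∷_ (f 0 (s≤s z≤n)) (!-extensional c d (NP.suc-injective l) (λ v p → f (suc v) (s≤s p)))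

inflate-injective : ∀ {K s} c d → IsPerm K s → NoRise s → length c ≡ K → length d ≡ K → inflate s c ≡ inflate s d → c ≡ d
inflate-injective {K} {s} c d (ls , us , as) irr lc ld e =
  !-extensional c d (trans lc (sym ld)) (λ v p → All.lookup (inflate-injective-on s c d irr e) (perm-covers K s us as ls v (subst (v <_) lc p)))

expand-inflate-∈ : ∀ {K s} c {w} → IsPerm K s → length c ≡ K → w ∈ inflate s c →
  ∃ λ d → length d ≡ length c × expand w (inflate s c) ≡ inflate s d
expand-inflate-∈ {s = s} c {w} (_ , _ , s<K) lc w∈ with inflate-∈⁻ s c w∈
... | u , u∈s , w≥ , w< = incAt u c , length-incAt u c , expand-inflate s c w u w≥ w< u<c
  where
  u<c : u < length c
  u<c = subst (u <_) (sym lc) (All.lookup s<K u∈s)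

contract-inflate-consec : ∀ {K s} c {w} → IsPerm K s → NoRise s → length c ≡ K →
  Consec w (suc w) (inflate s c) →
  ∃ λ d → length d ≡ length c × suc (sum d) ≡ sum c × contract (suc w) (inflate s c) ≡ inflate s d
contract-inflate-consec {s = s} c {w} (_ , _ , s<K) noRise lc rise with consec-inflate⁻ s c noRise rise
... | u , u∈s , w≥ , w+1< = d , length-decAt u c , sum-d , contracted
  where
  d : List ℕ
  d = decAt u c
  u<c : u < length c
  u<c = subst (u <_) (sym lc) (All.lookup s<K u∈s)
  -- block u contains both w and w+1, so it has size at least two
  c!u>0 : 0 < c ! u
  c!u>0 with c ! u
  ... | zero = ⊥-elim (NP.<⇒≱ w+1< (subst (_≤ suc w) (NP.+-comm 1 (offset c u)) (s≤s w≥)))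
  ... | suc _ = s≤s z≤n
  c≡ : incAt u d ≡ c
  c≡ = incAt-decAt u c u<c c!u>0
  u<d : u < length d
  u<d = subst (u <_) (sym (length-decAt u c)) u<c
  sum-d : suc (sum d) ≡ sum c
  sum-d = trans (sym (sum-incAt u d u<d)) (cong sum c≡)
  w+1>offset : offset d u < suc w
  w+1>offset = s≤s (subst (_≤ w) (trans (cong (λ z → offset z u) (sym c≡)) (offset-incAt-≤ u d u NP.≤-refl)) w≥)
  w+1≤end : suc w ≤ offset d (suc u)
  w+1≤end = NP.≤-pred (subst (suc (suc w) ≤_)
              (trans (cong (λ z → offset z (suc u)) (sym c≡)) (offset-incAt-> u d (suc u) (NP.n<1+n u) u<d)) w+1<)
  contracted : contract (suc w) (inflate s c) ≡ inflate s d
  contracted = trans (cong (λ z → contract (suc w) (inflate s z)) (sym c≡)) (contract-inflate s d (suc w) u w+1>offset w+1≤end u<d)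

inflate-++ : ∀ A B c → inflate (A ++ B) c ≡ inflate A c ++ inflate B c
inflate-++ [] B c = refl
inflate-++ (v ∷ A) B c = trans (cong (block c v ++_) (inflate-++ A B c)) (sym (LP.++-assoc (block c v) (inflate A c) (inflate B c)))

inflate-snoc-max : ∀ {m} X c → IsPerm m X →
  let L = inflate X c ++ range (offset c m) (c ! m) in inflate (X ++ [ length X ]) c ≡ L ++ [ length L ]
inflate-snoc-max {m} X c pX@(refl , _ , _) = begin
  inflate (X ++ [ m ]) c                          ≡⟨ inflate-++ X [ m ] c ⟩
  inflate X c ++ block c m ++ []                  ≡⟨ cong (inflate X c ++_) (LP.++-identityʳ (block c m)) ⟩
  inflate X c ++ range (offset c m) (suc (c ! m)) ≡⟨ cong (inflate X c ++_) (range-snoc (offset c m) (c ! m)) ⟩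
  inflate X c ++ (R ++ [ offset c m + c ! m ])    ≡⟨ sym (LP.++-assoc (inflate X c) R _) ⟩
  (inflate X c ++ R) ++ [ offset c m + c ! m ]    ≡⟨ cong (λ z → (inflate X c ++ R) ++ [ z ]) (sym length-L) ⟩
  (inflate X c ++ R) ++ [ length (inflate X c ++ R) ] ∎
  where
  open ≡-Reasoning
  R : List ℕ
  R = range (offset c m) (c ! m)
  length-L : length (inflate X c ++ R) ≡ offset c m + c ! m
  length-L = trans (LP.length-++ (inflate X c)) (cong₂ _+_ (length-inflate-perm c pX) (length-range (offset c m) (c ! m)))

snoc-view : ∀ (x : ℕ) xs → ∃₂ λ (ys : List ℕ) (y : ℕ) → x ∷ xs ≡ ys ++ [ y ]
snoc-view x [] = [] , x , refl
snoc-view x (x' ∷ xs) with snoc-view x' xs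
... | ys , y , e = x ∷ ys , y , cong (x ∷_) e

dropLast-snoc : ∀ xs y → dropLast (xs ++ [ y ]) ≡ xs
dropLast-snoc [] y = refl
dropLast-snoc (x ∷ []) y = refl
dropLast-snoc (x ∷ x' ∷ xs) y = cong (x ∷_) (dropLast-snoc (x' ∷ xs) y)

lastIsMax-snoc : ∀ xs y → lastIsMax (xs ++ [ y ]) ≡ (y ≡ᵇ length xs)
lastIsMax-snoc [] y = refl
lastIsMax-snoc (x ∷ xs) y with reverse (x ∷ xs ++ [ y ]) | LP.reverse-++ (x ∷ xs) [ y ]
... | .(y ∷ _) | refl rewrite LP.length-++ xs {[ y ]} | NP.+-comm (length xs) 1 = refl

lastIsMax⇒snoc : ∀ π → lastIsMax π ≡ true → ∃ λ ρ → π ≡ ρ ++ [ length ρ ]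
lastIsMax⇒snoc (x ∷ xs) e with snoc-view x xs
... | ys , y , eq = ys , trans eq (cong (λ z → ys ++ [ z ]) (≡ᵇ-true⇒ (trans (sym (lastIsMax-snoc ys y)) (trans (cong lastIsMax (sym eq)) e))))

firstIsZero⇒∷ : ∀ π → firstIsZero π ≡ true → ∃ λ ρ → π ≡ 0 ∷ ρ
firstIsZero⇒∷ (x ∷ ρ) e = ρ , cong (_∷ ρ) (≡ᵇ-true⇒ e)

lastIsMax-snoc-length : ∀ ys y → length ys ≡ y → lastIsMax (ys ++ [ y ]) ≡ true
lastIsMax-snoc-length ys y refl rewrite lastIsMax-snoc ys (length ys) = ≡ᵇ-refl (length ys)

-- Framing.  'frameFirst true π' prepends a new least entry 0 (shifting π
-- up) and 'frameLast true L' appends a new greatest entry |L|.  'frame t π'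
-- applies them as the type t requires; this turns the boundary adjacencies
-- of types 2–4 into ordinary (type 1) adjacencies of the framed list.
frameFirst : Bool → List ℕ → List ℕ
frameFirst false π = π
frameFirst true π = 0 ∷ map suc π

frameLast : Bool → List ℕ → List ℕ
frameLast false L = L
frameLast true L = L ++ [ length L ]

frame : AdjType → List ℕ → List ℕ
frame t π = frameLast (countsLast t) (frameFirst (countsFirst t) π)

framedLength : AdjType → ℕ → ℕ
framedLength t n = (b2n (countsFirst t) + n) + b2n (countsLast t)

length-frameFirst : ∀ b π → length (frameFirst b π) ≡ b2n b + length π
length-frameFirst false π = refl
length-frameFirst true π = cong suc (LP.length-map suc π)

length-frameLast : ∀ b L → length (frameLast b L) ≡ length L + b2n b
length-frameLast false L = sym (NP.+-identityʳ _)
length-frameLast true L = LP.length-++ L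

length-frame : ∀ t π → length (frame t π) ≡ framedLength t (length π)
length-frame t π = trans (length-frameLast (countsLast t) _) (cong (_+ b2n (countsLast t)) (length-frameFirst (countsFirst t) π))

frameFirst-perm : ∀ b {n π} → IsPerm n π → IsPerm (b2n b + n) (frameFirst b π)
frameFirst-perm false p = p
frameFirst-perm true {n} {π} (l , u , a) =
  cong suc (trans (LP.length-map suc π) l) ,
  (All.tabulate (λ {x} q e → case0 (sym e) q) ∷ UP.map⁺ NP.suc-injective u) ,
  (s≤s z≤n ∷ AP.map⁺ (All.map s≤s a))
  where case0 : ∀ {x} → x ≡ 0 → x ∈ map suc π → ⊥
        case0 refl q with ∈-map⁻ suc q
        ... | _ , _ , ()

frameFirst-perm⁻ : ∀ b {n π} → IsPerm (b2n b + n) (frameFirst b π) → IsPerm n π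
frameFirst-perm⁻ false p = p
frameFirst-perm⁻ true {n} {π} (l , (_ ∷ u) , (_ ∷ a)) =
  trans (sym (LP.length-map suc π)) (NP.suc-injective l) , UP.map⁻ u , All.map (λ { (s≤s q) → q }) (AP.map⁻ a)

frameLast-perm : ∀ b {m L} → IsPerm m L → IsPerm (m + b2n b) (frameLast b L)
frameLast-perm false {m} {L} p = subst (λ z → IsPerm z L) (sym (NP.+-identityʳ m)) p
frameLast-perm true {m} {L} (l , u , a) =
  trans (LP.length-++ L) (cong (_+ 1) l) ,
  UP.++⁺ u ([] ∷ []) (λ { (p , here refl) → NP.<-irrefl l (All.lookup a p) }) ,
  AP.++⁺ (All.map (λ q → NP.<-trans q m<m+1) a) (subst (_< m + 1) (sym l) m<m+1 ∷ [])
  where m<m+1 : m < m + 1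
        m<m+1 = subst (m <_) (NP.+-comm 1 m) (NP.n<1+n m)

frameLast-perm⁻ : ∀ b {m L} → IsPerm (m + b2n b) (frameLast b L) → IsPerm m L
frameLast-perm⁻ false {m} {L} p = subst (λ z → IsPerm z L) (NP.+-identityʳ m) p
frameLast-perm⁻ true {m} {L} (l , u , a) =
  lL , unique-++ˡ u , All.tabulate λ {x} q → lt x q
  where
  lL : length L ≡ m
  lL = NP.+-cancelʳ-≡ 1 (length L) m (trans (sym (LP.length-++ L)) l)
  lt : ∀ x → x ∈ L → x < m
  lt x q = NP.≤∧≢⇒< (NP.≤-pred (subst (x <_) (NP.+-comm m 1) (All.lookup a (∈-++⁺ˡ q))))
                    (λ e → unique-++-disjoint u q (here (trans e (sym lL))))

frame-perm : ∀ t {n π} → IsPerm n π → IsPerm (framedLength t n) (frame t π)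
frame-perm t p = frameLast-perm (countsLast t) (frameFirst-perm (countsFirst t) p)

frame-perm⁻ : ∀ t {n π} → IsPerm (framedLength t n) (frame t π) → IsPerm n π
frame-perm⁻ t p = frameFirst-perm⁻ (countsFirst t) (frameLast-perm⁻ (countsLast t) p)

unframeFirst : Bool → List ℕ → List ℕ
unframeFirst false L = L
unframeFirst true L = map pred (drop 1 L)

unframeLast : Bool → List ℕ → List ℕ
unframeLast false L = L
unframeLast true L = dropLast L

unframe : AdjType → List ℕ → List ℕ
unframe t L = unframeFirst (countsFirst t) (unframeLast (countsLast t) L)

unframe-frame : ∀ t π → unframe t (frame t π) ≡ π
unframe-frame t π = trans (cong (unframeFirst (countsFirst t)) (uL (countsLast t) _)) (uF (countsFirst t) π)
  where
  uL : ∀ b M → unframeLast b (frameLast b M) ≡ M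
  uL false M = refl
  uL true M = dropLast-snoc M (length M)
  uF : ∀ b π → unframeFirst b (frameFirst b π) ≡ π
  uF false π = refl
  uF true π = trans (sym (LP.map-∘ π)) (LP.map-id π)

frame-injective : ∀ t {π ρ} → frame t π ≡ frame t ρ → π ≡ ρ
frame-injective t {π} {ρ} e = trans (sym (unframe-frame t π)) (trans (cong (unframe t) e) (unframe-frame t ρ))

frameFirst-unframeFirst : ∀ ρ → Unique (0 ∷ ρ) → frameFirst true (unframeFirst true (0 ∷ ρ)) ≡ 0 ∷ ρ
frameFirst-unframeFirst ρ (0∉ρ ∷ _) =
  cong (0 ∷_) (trans (sym (LP.map-∘ ρ)) (LP.map-id-local (All.map suc-pred 0∉ρ)))
  where
  suc-pred : ∀ {x} → 0 ≢ x → suc (pred x) ≡ x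
  suc-pred {zero} 0≢0 = ⊥-elim (0≢0 refl)
  suc-pred {suc x} _ = refl

frameFirst-unframeFirst-inflate : ∀ b σ c Y → Unique (inflate (frameFirst b σ) c ++ Y) →
  frameFirst b (unframeFirst b (inflate (frameFirst b σ) c ++ Y)) ≡ inflate (frameFirst b σ) c ++ Y
frameFirst-unframeFirst-inflate false σ c Y u = refl
frameFirst-unframeFirst-inflate true σ c Y u = frameFirst-unframeFirst _ u

frameLast-restore : ∀ (f : List ℕ → List ℕ) L L' → L ≡ L' ++ [ length L' ] → f L' ≡ L' →
  frameLast true (f (unframeLast true L)) ≡ L
frameLast-restore f L L' refl fL' = cong (λ z → z ++ [ length z ]) (trans (cong f (dropLast-snoc L' (length L'))) fL')

-- Unframing an inflation of a framed permutation and framing it again gives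
-- it back: inflation keeps a leading 0 in front and a final maximum last.
frame-unframe-inflate : ∀ bF bL {k σ} c → IsPerm k σ →
  let L = inflate (frameLast bL (frameFirst bF σ)) c in
  frameLast bL (frameFirst bF (unframeFirst bF (unframeLast bL L))) ≡ L
frame-unframe-inflate false false c p = refl
frame-unframe-inflate true false c p = frameFirst-unframeFirst _ (unique-inflate _ c (proj₁ (proj₂ (frameFirst-perm true p))))
frame-unframe-inflate bF true {k} {σ} c p =
  frameLast-restore (λ z → frameFirst bF (unframeFirst bF z)) _ _ e
    (frameFirst-unframeFirst-inflate bF σ c _ (unique-++ˡ (subst Unique e unique-L)))
  where
  X : List ℕ
  X = frameFirst bF σ
  pX : IsPerm (b2n bF + k) X
  pX = frameFirst-perm bF p
  L' : List ℕ
  L' = inflate X c ++ range (offset c (b2n bF + k)) (c ! (b2n bF + k))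
  e : inflate (frameLast true X) c ≡ L' ++ [ length L' ]
  e = inflate-snoc-max X c pX
  unique-L : Unique (inflate (frameLast true X) c)
  unique-L = unique-inflate _ c (proj₁ (proj₂ (frameLast-perm true pX)))

delAdj1'-split : ∀ x r {v r'} → delAdj1' x r ≡ just (v , r') →
  ∃₂ λ A w → ∃ λ B → x ∷ r ≡ A ++ w ∷ suc w ∷ B × v ≡ suc w × r' ≡ A ++ w ∷ B
delAdj1'-split x [] ()
delAdj1'-split x (y ∷ r) e with y ≡ᵇ suc x in eq
delAdj1'-split x (y ∷ r) refl | true = [] , x , r , cong (λ z → x ∷ z ∷ r) (≡ᵇ-true⇒ eq) , ≡ᵇ-true⇒ eq , refl
delAdj1'-split x (y ∷ r) e | false with delAdj1' y r in eq2
delAdj1'-split x (y ∷ r) refl | false | just (v' , r'') with delAdj1'-split y r eq2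
... | A , w , B , e1 , e2 , e3 = x ∷ A , w , B , cong (x ∷_) e1 , e2 , cong (x ∷_) e3
delAdj1'-split x (y ∷ r) () | false | nothing

delAdj1-split : ∀ π {v r'} → delAdj1 π ≡ just (v , r') →
  ∃₂ λ A w → ∃ λ B → π ≡ A ++ w ∷ suc w ∷ B × v ≡ suc w × r' ≡ A ++ w ∷ B
delAdj1-split (x ∷ r) e = delAdj1'-split x r e

delAdj1'-finds : ∀ x r {w} → Consec w (suc w) (x ∷ r) → ∃ λ p → delAdj1' x r ≡ just p
delAdj1'-finds x [] (there ())
delAdj1'-finds x (y ∷ r) c with y ≡ᵇ suc x in eq
... | true = _ , refl
delAdj1'-finds x (y ∷ r) here | false rewrite ≡ᵇ-refl (suc x) = case eq of λ ()
delAdj1'-finds x (y ∷ r) (there c) | false with delAdj1' y r | delAdj1'-finds y r c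
... | just p | _ , refl = _ , refl

delAdj1-finds : ∀ π {w} → Consec w (suc w) π → ∃ λ p → delAdj1 π ≡ just p
delAdj1-finds (x ∷ r) c = delAdj1'-finds x r c

consec⇒adj1≢0 : ∀ π {w} → Consec w (suc w) π → adj1 π ≢ 0
consec⇒adj1≢0 (x ∷ .(suc x) ∷ r) here e rewrite ≡ᵇ-refl (suc x) = case e of λ ()
consec⇒adj1≢0 (x ∷ y ∷ r) (there c) e = consec⇒adj1≢0 (y ∷ r) c (NP.m+n≡0⇒n≡0 (b2n (y ≡ᵇ suc x)) e)

step-just⁻ : ∀ t π {π'} → step t π ≡ just π' →
  (∃₂ λ v r → delAdj1 π ≡ just (v , r) × π' ≡ relabel v r)
  ⊎ ((countsLast t ∧ lastIsMax π) ≡ true × π' ≡ dropLast π)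
  ⊎ ((countsFirst t ∧ firstIsZero π) ≡ true × π' ≡ relabel 0 (drop 1 π))
step-just⁻ t π e with delAdj1 π
step-just⁻ t π refl | just (v , r) = inj₁ (v , r , refl , refl)
step-just⁻ t π e | nothing with countsLast t ∧ lastIsMax π
step-just⁻ t π refl | nothing | true = inj₂ (inj₁ (refl , refl))
step-just⁻ t π e | nothing | false with countsFirst t ∧ firstIsZero π
step-just⁻ t π refl | nothing | false | true = inj₂ (inj₂ (refl , refl))
step-just⁻ t π () | nothing | false | false

step-nothing⁻ : ∀ t π → step t π ≡ nothing →
  delAdj1 π ≡ nothing × (countsLast t ∧ lastIsMax π) ≡ false × (countsFirst t ∧ firstIsZero π) ≡ false
step-nothing⁻ t π e with delAdj1 π
step-nothing⁻ t π () | just _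
... | nothing with countsLast t ∧ lastIsMax π
step-nothing⁻ t π () | nothing | true
... | false with countsFirst t ∧ firstIsZero π
step-nothing⁻ t π () | nothing | false | true
... | false = refl , refl , refl

FirstFramedStep : Bool → List ℕ → List ℕ → Set
FirstFramedStep bF π π' =
  ∃ λ w → Consec w (suc w) (frameFirst bF π) × frameFirst bF π' ≡ contract (suc w) (frameFirst bF π)

FramedStep : Bool → Bool → List ℕ → List ℕ → Set
FramedStep bF bL π π' =
  ∃ λ w → Consec w (suc w) (frameLast bL (frameFirst bF π))
        × frameLast bL (frameFirst bF π') ≡ contract (suc w) (frameLast bL (frameFirst bF π))

-- Deleting an interior adjacency; under the front frame all values are
-- shifted by one, which contraction commutes with.
firstFramed-delAdj1 : ∀ bF π {v r π'} → Unique π → delAdj1 π ≡ just (v , r) → π' ≡ relabel v r → FirstFramedStep bF π π'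
firstFramed-delAdj1 bF π u e refl with delAdj1-split π e
firstFramed-delAdj1 false π u e refl | A , w , B , refl , refl , refl = w , consec-mid A B , sym (contract-adjacent A w B u)
firstFramed-delAdj1 true π u e refl | A , w , B , refl , refl , refl =
  suc w , there (consec-map-suc⁺ _ (consec-mid A B)) ,
  sym (trans (contract-miss {suc (suc w)} {0} (map suc (A ++ w ∷ suc w ∷ B)) (λ ()))
        (cong₂ _∷_ (lower-≤ {suc (suc w)} {0} z≤n)
          (trans (contract-map-suc (suc w) (A ++ w ∷ suc w ∷ B)) (cong (map suc) (contract-adjacent A w B u)))))

-- Deleting a leading 0 is contracting the front-framed adjacency 0, 1.
firstFramed-dropFirst : ∀ bF π {π'} → Unique π → (bF ∧ firstIsZero π) ≡ true → π' ≡ relabel 0 (drop 1 π) → FirstFramedStep bF π π'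
firstFramed-dropFirst false π u () _
firstFramed-dropFirst true π u e refl with firstIsZero⇒∷ π e
firstFramed-dropFirst true π (p ∷ u) e refl | ρ , refl = 0 , here ,
  sym (trans (contract-miss {1} {0} (1 ∷ map suc ρ) (λ ()))
        (cong₂ _∷_ (lower-≤ {1} {0} z≤n) (trans (contract-hit 1 (map suc ρ)) (trans (contract-map-suc 0 ρ)
           (cong (λ z → map suc (relabel 0 z)) (remove-∉ 0 ρ (λ q → All.lookup p q refl)))))))

contract-frameLast : ∀ b M u → u ∈ M → Unique M → All (_< length M) M → contract u (frameLast b M) ≡ frameLast b (contract u M)
contract-frameLast false M u _ _ _ = refl
contract-frameLast true M u uM un aM = trans (contract-++ u M [ length M ]) (cong (contract u M ++_) single)
  where
  u<M : u < length M
  u<M = All.lookup aM uM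
  single : contract u [ length M ] ≡ [ length (contract u M) ]
  single rewrite contract-miss {u} {length M} [] (λ e → NP.<⇒≢ u<M (sym e)) | lower-> {u} {length M} u<M
    = cong [_] (sym (trans (LP.length-map (lower u) (remove u M)) (length-remove u M uM un)))

framedStep-frameLast : ∀ bF bL π π' → IsPerm (length π) π → FirstFramedStep bF π π' → FramedStep bF bL π π'
framedStep-frameLast bF bL π π' p (w , c , e) with frameFirst-perm bF p
... | lM , uM , aM' = w , cL bL , trans (cong (frameLast bL) e) (sym (contract-frameLast bL (frameFirst bF π) (suc w) (consec-mem₂ c) uM aM))
  where
  aM : All (_< length (frameFirst bF π)) (frameFirst bF π)
  aM = subst (λ z → All (_< z) (frameFirst bF π)) (sym lM) aM'
  cL : ∀ b → Consec w (suc w) (frameLast b (frameFirst bF π))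
  cL false = c
  cL true = consec-++ˡ (frameFirst bF π) _ c

-- Deleting a final maximum m is contracting the back-framed adjacency m, m+1.
contract-last-pair : ∀ M m → All (_< m) M → contract (suc m) (M ++ m ∷ suc m ∷ []) ≡ M ++ [ m ]
contract-last-pair M m M<m = begin
  contract (suc m) (M ++ m ∷ suc m ∷ [])                ≡⟨ contract-++ (suc m) M _ ⟩
  contract (suc m) M ++ contract (suc m) (m ∷ suc m ∷ []) ≡⟨ cong₂ _++_ (contract-below (suc m) M (All.map NP.m<n⇒m<1+n M<m)) last-pair ⟩
  M ++ [ m ]                                              ∎
  where
  open ≡-Reasoning
  last-pair : contract (suc m) (m ∷ suc m ∷ []) ≡ [ m ]
  last-pair rewrite contract-miss {suc m} {m} [ suc m ] (λ e → NP.1+n≢n (sym e)) | contract-hit (suc m) [] = cong [_] (lower-≤ (NP.n≤1+n m))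

frameFirst-snoc : ∀ b ρ → frameFirst b (ρ ++ [ length ρ ]) ≡ frameFirst b ρ ++ [ length (frameFirst b ρ) ]
frameFirst-snoc false ρ = refl
frameFirst-snoc true ρ = cong (0 ∷_) (trans (LP.map-++ suc ρ [ length ρ ]) (cong (λ z → map suc ρ ++ [ suc z ]) (sym (LP.length-map suc ρ))))

framedStep-dropLast : ∀ bF π → IsPerm (length π) π → lastIsMax π ≡ true → FramedStep bF true π (dropLast π)
framedStep-dropLast bF π p e with lastIsMax⇒snoc π e
... | ρ , refl = length M , subst (Consec (length M) (suc (length M))) (sym framed) (consec-mid M []) , contracted
  where
  M : List ℕ
  M = frameFirst bF ρ
  M-perm : IsPerm (length M) M
  M-perm = subst (λ z → IsPerm z M) (sym (length-frameFirst bF ρ)) (frameFirst-perm bF (frameLast-perm⁻ true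
             (subst (λ z → IsPerm z (ρ ++ [ length ρ ])) (LP.length-++ ρ) p)))
  framed : frameLast true (frameFirst bF (ρ ++ [ length ρ ])) ≡ M ++ length M ∷ suc (length M) ∷ []
  framed = begin
    frameLast true (frameFirst bF (ρ ++ [ length ρ ]))       ≡⟨ cong (frameLast true) (frameFirst-snoc bF ρ) ⟩
    (M ++ [ length M ]) ++ [ length (M ++ [ length M ]) ]    ≡⟨ LP.++-assoc M _ _ ⟩
    M ++ length M ∷ length (M ++ [ length M ]) ∷ []          ≡⟨ cong (λ z → M ++ length M ∷ z ∷ []) (trans (LP.length-++ M) (NP.+-comm (length M) 1)) ⟩
    M ++ length M ∷ suc (length M) ∷ []                      ∎
    where open ≡-Reasoning
  contracted : frameLast true (frameFirst bF (dropLast (ρ ++ [ length ρ ])))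
             ≡ contract (suc (length M)) (frameLast true (frameFirst bF (ρ ++ [ length ρ ])))
  contracted = begin
    frameLast true (frameFirst bF (dropLast (ρ ++ [ length ρ ])))  ≡⟨ cong (λ z → frameLast true (frameFirst bF z)) (dropLast-snoc ρ (length ρ)) ⟩
    M ++ [ length M ]                                               ≡⟨ sym (contract-last-pair M (length M) (proj₂ (proj₂ M-perm))) ⟩
    contract (suc (length M)) (M ++ length M ∷ suc (length M) ∷ []) ≡⟨ cong (contract (suc (length M))) (sym framed) ⟩
    contract (suc (length M)) (frameLast true (frameFirst bF (ρ ++ [ length ρ ]))) ∎
    where open ≡-Reasoning

framedStep-cases : ∀ bF bL π π' → IsPerm (length π) π →
  (∃₂ λ v r → delAdj1 π ≡ just (v , r) × π' ≡ relabel v r)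
  ⊎ ((bL ∧ lastIsMax π) ≡ true × π' ≡ dropLast π)
  ⊎ ((bF ∧ firstIsZero π) ≡ true × π' ≡ relabel 0 (drop 1 π)) → FramedStep bF bL π π'
framedStep-cases bF bL π π' p (inj₁ (v , r , e , e')) = framedStep-frameLast bF bL π π' p (firstFramed-delAdj1 bF π (proj₁ (proj₂ p)) e e')
framedStep-cases bF bL π π' p (inj₂ (inj₂ (e , e'))) = framedStep-frameLast bF bL π π' p (firstFramed-dropFirst bF π (proj₁ (proj₂ p)) e e')
framedStep-cases bF true π π' p (inj₂ (inj₁ (e , refl))) = framedStep-dropLast bF π p e
framedStep-cases bF false π π' p (inj₂ (inj₁ (() , _)))

step⇒framedStep : ∀ t π {π'} → IsPerm (length π) π → step t π ≡ just π' →
  ∃ λ w → Consec w (suc w) (frame t π) × frame t π' ≡ contract (suc w) (frame t π)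
step⇒framedStep t π p e = framedStep-cases (countsFirst t) (countsLast t) π _ p (step-just⁻ t π e)

consec-frameFirst⁻ : ∀ bF π {w} → Consec w (suc w) (frameFirst bF π) → (∃ λ w' → Consec w' (suc w') π) ⊎ (bF ∧ firstIsZero π) ≡ true
consec-frameFirst⁻ false π c = inj₁ (_ , c)
consec-frameFirst⁻ true (.0 ∷ π₀) here = inj₂ refl
consec-frameFirst⁻ true π (there c) with consec-map-suc⁻ π c
... | x' , y' , refl , e2 , c' = inj₁ (x' , subst (λ z → Consec x' z π) (sym (NP.suc-injective e2)) c')

consec-frame⁻ : ∀ bF bL π {w} → π ≢ [] → Consec w (suc w) (frameLast bL (frameFirst bF π)) →
  (∃ λ w' → Consec w' (suc w') π) ⊎ (bL ∧ lastIsMax π) ≡ true ⊎ (bF ∧ firstIsZero π) ≡ true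
consec-frame⁻ bF false π ne c with consec-frameFirst⁻ bF π c
... | inj₁ x = inj₁ x
... | inj₂ x = inj₂ (inj₂ x)
consec-frame⁻ bF true π {w} ne c with consec-++⁻ (frameFirst bF π) [ length (frameFirst bF π) ] c
... | inj₁ c' with consec-frameFirst⁻ bF π c'
...   | inj₁ x = inj₁ x
...   | inj₂ x = inj₂ (inj₂ x)
consec-frame⁻ bF true π {w} ne c | inj₂ (inj₁ (there ()))
consec-frame⁻ false true π {w} ne c | inj₂ (inj₂ ((A' , refl) , (B' , eB))) =
  inj₂ (inj₁ (lastIsMax-snoc-length A' w
    (NP.suc-injective (trans (sym (trans (LP.length-++ A') (NP.+-comm (length A') 1))) (proj₁ (LP.∷-injective eB))))))
consec-frame⁻ true true [] {w} ne c | inj₂ (inj₂ _) = ⊥-elim (ne refl)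
consec-frame⁻ true true (x ∷ xs) {w} ne c | inj₂ (inj₂ ((A' , eA) , (B' , eB))) with snoc-view x xs
... | ys , y , eq = inj₂ (inj₁ (subst (λ z → lastIsMax z ≡ true) (sym eq) (lastIsMax-snoc-length ys y lys)))
  where
  eA' : (0 ∷ map suc ys) ++ [ suc y ] ≡ A' ++ [ w ]
  eA' = trans (cong (0 ∷_) (sym (trans (cong (map suc) eq) (LP.map-++ suc ys [ y ])))) eA
  wy : w ≡ suc y
  wy = sym (LP.∷ʳ-injectiveʳ (0 ∷ map suc ys) A' eA')
  lπ : length (x ∷ xs) ≡ w
  lπ = NP.suc-injective (trans (cong suc (sym (LP.length-map suc (x ∷ xs)))) (proj₁ (LP.∷-injective eB)))
  lys : length ys ≡ y
  lys = NP.suc-injective (trans (trans (NP.+-comm 1 (length ys)) (sym (LP.length-++ ys {[ y ]}))) (trans (cong length (sym eq)) (trans lπ wy)))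

adj≡0⁻ : ∀ t σ → adj t σ ≡ 0 →
  adj1 σ ≡ 0 × (countsLast t ∧ lastIsMax σ) ≡ false × (countsFirst t ∧ firstIsZero σ) ≡ false
adj≡0⁻ t σ e =
  NP.m+n≡0⇒m≡0 (adj1 σ) (NP.m+n≡0⇒m≡0 (adj1 σ + _) e) ,
  b2n≡0⇒false (NP.m+n≡0⇒n≡0 (adj1 σ) (NP.m+n≡0⇒m≡0 (adj1 σ + _) e)) ,
  b2n≡0⇒false (NP.m+n≡0⇒n≡0 (adj1 σ + _) e)

true≢false : true ≢ false
true≢false ()

noRise-frame : ∀ t σ → σ ≢ [] → adj t σ ≡ 0 → NoRise (frame t σ)
noRise-frame t σ ne a w c with adj≡0⁻ t σ a | consec-frame⁻ (countsFirst t) (countsLast t) σ ne c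
... | a1 , _ , _ | inj₁ (w' , c') = consec⇒adj1≢0 σ c' a1
... | _ , a2 , _ | inj₂ (inj₁ e) = true≢false (trans (sym e) a2)
... | _ , _ , a3 | inj₂ (inj₂ e) = true≢false (trans (sym e) a3)

consec-frame⇒step : ∀ t π {w} → π ≢ [] → Consec w (suc w) (frame t π) → step t π ≢ nothing
consec-frame⇒step t π ne c e with step-nothing⁻ t π e | consec-frame⁻ (countsFirst t) (countsLast t) π ne c
... | d , _ , _ | inj₁ (w' , c') with delAdj1-finds π c'
...   | _ , e' = case trans (sym d) e' of λ ()
consec-frame⇒step t π ne c e | _ , a2 , _ | inj₂ (inj₁ x) = true≢false (trans (sym x) a2)
consec-frame⇒step t π ne c e | _ , _ , a3 | inj₂ (inj₂ x) = true≢false (trans (sym x) a3)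

step-perm : ∀ t π {π'} → IsPerm (length π) π → step t π ≡ just π' → IsPerm (length π') π'
step-perm t π {π'} p e with step⇒framedStep t π p e
... | w , adj , eq = frame-perm⁻ t (subst (λ z → IsPerm z (frame t π')) length≡ framed-perm)
  where
  framed-perm : IsPerm _ (frame t π')
  framed-perm = subst (IsPerm _) (sym eq) (contract-perm (frame-perm t p) (consec-mem₂ adj))
  length≡ : _ ≡ framedLength t (length π')
  length≡ = trans (sym (proj₁ framed-perm)) (length-frame t π')

prefixAll : List (List ℕ) → List ℕ → List (List ℕ)
prefixAll W xs = concatMap (λ x → map (x ∷_) W) xs

prefixAll-∈⁻ : ∀ W xs {y} → y ∈ prefixAll W xs → ∃₂ λ x ρ → x ∈ xs × ρ ∈ W × y ≡ x ∷ ρ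
prefixAll-∈⁻ W (x ∷ xs) q with ∈-++⁻ (map (x ∷_) W) q
... | inj₁ q' = let (ρ , ρW , e) = ∈-map⁻ (x ∷_) q' in x , ρ , here refl , ρW , e
... | inj₂ q' = let (x' , ρ , a , b , e) = prefixAll-∈⁻ W xs q' in x' , ρ , there a , b , e

prefixAll-∈⁺ : ∀ W xs {x ρ} → x ∈ xs → ρ ∈ W → x ∷ ρ ∈ prefixAll W xs
prefixAll-∈⁺ W (x ∷ xs) (here refl) q = ∈-++⁺ˡ (∈-map⁺ (x ∷_) q)
prefixAll-∈⁺ W (x ∷ xs) (there p) q = ∈-++⁺ʳ (map (x ∷_) W) (prefixAll-∈⁺ W xs p q)

unique-prefixAll : ∀ W xs → Unique W → Unique xs → Unique (prefixAll W xs)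
unique-prefixAll W [] _ _ = []
unique-prefixAll W (x ∷ xs) uW (p ∷ u) = UP.++⁺ (UP.map⁺ (λ e → proj₂ (LP.∷-injective e)) uW) (unique-prefixAll W xs uW u) disj
  where
  disj : ∀ {y} → ¬ (y ∈ map (x ∷_) W × y ∈ prefixAll W xs)
  disj (q1 , q2) with ∈-map⁻ (x ∷_) q1 | prefixAll-∈⁻ W xs q2
  ... | ρ , _ , refl | x' , ρ' , x'in , _ , e = All.lookup p x'in (proj₁ (LP.∷-injective e))

words-∈⁻ : ∀ m len {π} → π ∈ words m len → length π ≡ len × All (_< m) π
words-∈⁻ m zero (here refl) = refl , []
words-∈⁻ m (suc len) q with prefixAll-∈⁻ (words m len) (upTo m) q
... | x , ρ , xin , ρin , refl = let (l , a) = words-∈⁻ m len ρin in cong suc l , ∈-upTo⁻ xin ∷ a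

words-∈⁺ : ∀ m len {π} → length π ≡ len → All (_< m) π → π ∈ words m len
words-∈⁺ m zero {[]} l a = here refl
words-∈⁺ m (suc len) {x ∷ π} l (ax ∷ a) = prefixAll-∈⁺ (words m len) (upTo m) (∈-upTo⁺ ax) (words-∈⁺ m len (NP.suc-injective l) a)

words-unique : ∀ m len → Unique (words m len)
words-unique m zero = [] ∷ []
words-unique m (suc len) = unique-prefixAll (words m len) (upTo m) (words-unique m len) (UP.upTo⁺ m)

P-∈⁻ : ∀ {m π} → π ∈ P m → IsPerm m π
P-∈⁻ {m} q with ∈-filter⁻ unique? {xs = words m m} q
... | w , u = let (l , a) = words-∈⁻ m m w in l , u , a

P-∈⁺ : ∀ {m π} → IsPerm m π → π ∈ P m
P-∈⁺ {m} (l , u , a) = ∈-filter⁺ unique? (words-∈⁺ m m l a) u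

unique-P : ∀ m → Unique (P m)
unique-P m = UP.filter⁺ unique? (words-unique m m)

-- Weak compositions: lists c of K naturals with K + sum c = N.  Their
-- entries are at most N, so they are found among the words over {0,…,N}.
-- This list depends only on K and N.
compositions : ℕ → ℕ → List (List ℕ)
compositions K N = filter (λ c → K + sum c ≟ N) (words (suc N) K)

compositions-∈⁻ : ∀ {K N c} → c ∈ compositions K N → length c ≡ K × K + sum c ≡ N
compositions-∈⁻ {K} {N} c∈ with ∈-filter⁻ (λ c → K + sum c ≟ N) {xs = words (suc N) K} c∈
... | c∈words , total = proj₁ (words-∈⁻ (suc N) K c∈words) , total

compositions-∈⁺ : ∀ {K N c} → length c ≡ K → K + sum c ≡ N → c ∈ compositions K N
compositions-∈⁺ {K} {N} {c} lc total = ∈-filter⁺ (λ c → K + sum c ≟ N) (words-∈⁺ (suc N) K lc bounded) total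
  where
  bounded : All (_< suc N) c
  bounded = All.tabulate λ {x} x∈c → s≤s (NP.≤-trans (∈⇒≤sum c x∈c) (subst (sum c ≤_) total (NP.m≤n+m (sum c) K)))

unique-compositions : ∀ K N → Unique (compositions K N)
unique-compositions K N = UP.filter⁺ _ (words-unique (suc N) K)

-- The excess of a framed inflation over the framed σ is the excess of π
-- over σ, hence at most |π|.
framedLength-excess : ∀ t {k n s} → framedLength t k + s ≡ framedLength t n → s ≤ n
framedLength-excess t {k} {n} {s} e = subst (s ≤_) k+s≡n (NP.m≤n+m s k)
  where
  a b : ℕ
  a = b2n (countsFirst t)
  b = b2n (countsLast t)
  k+s≡n : k + s ≡ n
  k+s≡n = NP.+-cancelˡ-≡ a _ _ (NP.+-cancelʳ-≡ b _ _ (begin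
    (a + (k + s)) + b ≡⟨ cong (_+ b) (sym (NP.+-assoc a k s)) ⟩
    ((a + k) + s) + b ≡⟨ NP.+-assoc (a + k) s b ⟩
    (a + k) + (s + b) ≡⟨ cong ((a + k) +_) (NP.+-comm s b) ⟩
    (a + k) + (b + s) ≡⟨ sym (NP.+-assoc (a + k) b s) ⟩
    ((a + k) + b) + s ≡⟨ e ⟩
    (a + n) + b       ∎))
    where open ≡-Reasoning

module Fibre (t : AdjType) {k : ℕ} {σ : List ℕ} (σ-perm : IsPerm k σ) (σ-irr : adj t σ ≡ 0) (k≥1 : 1 ≤ k) where

  σ̂ : List ℕ
  σ̂ = frame t σ

  K : ℕ
  K = framedLength t k

  σ̂-perm : IsPerm K σ̂
  σ̂-perm = frame-perm t σ-perm

  σ̂-noRise : NoRise σ̂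
  σ̂-noRise = noRise-frame t σ (λ { refl → NP.<⇒≱ k≥1 (NP.≤-reflexive (sym (proj₁ σ-perm))) }) σ-irr

  IsInflation : List ℕ → List ℕ → Set
  IsInflation π c = length c ≡ K × frame t π ≡ inflate σ̂ c

  length-inflate-σ̂ : ∀ c → length c ≡ K → length (inflate σ̂ c) ≡ K + sum c
  length-inflate-σ̂ c lc = trans (length-inflate-perm c σ̂-perm) (subst (λ z → offset c z ≡ z + sum c) lc (offset-length c))

  σ-isInflation : ∃ (IsInflation σ)
  σ-isInflation = replicate K 0 , LP.length-replicate K , sym (inflate-zeros σ̂ _ (replicate-! K))

  inflation-trivial : ∀ {π c} → frame t π ≡ inflate σ̂ c → sum c ≡ 0 → π ≡ σ
  inflation-trivial {c = c} e s0 = frame-injective t (trans e (inflate-zeros σ̂ c (sum≡0⇒!≡0 c s0)))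

  inflation-nonempty : ∀ {π c} → frame t π ≡ inflate σ̂ c → π ≢ []
  inflation-nonempty {π} {c} e refl = NP.<⇒≱ k≥1 (NP.+-cancelˡ-≤ (b2n (countsFirst t)) k 0 (NP.+-cancelʳ-≤ (b2n (countsLast t)) _ _ framed≤))
    where
    framed≤ : framedLength t k ≤ framedLength t 0
    framed≤ = subst₂ _≤_ (trans (length-frame t σ) (cong (framedLength t) (proj₁ σ-perm)))
                         (trans (cong length (sym e)) (length-frame t [])) (length-inflate-≥ σ̂ c)

  -- Undoing a step: if π steps to π' and π' is an inflation of σ̂, so is π
  -- (re-insert the deleted value by expanding the frame of π').
  step-backward : ∀ π {π'} → IsPerm (length π) π → step t π ≡ just π' →
                  ∃ (IsInflation π') → ∃ (IsInflation π)
  step-backward π p stepped (c' , lc' , e') with step⇒framedStep t π p stepped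
  ... | w , rise , framed
      with expand-inflate-∈ c' σ̂-perm lc' (subst (w ∈_) (trans (sym framed) e') (consec-∈-contract rise))
  ...   | d , ld , expanded = d , trans ld lc' , (begin
    frame t π                                  ≡⟨ sym (expand-contract w (frame t π) (proj₁ (proj₂ (frame-perm t p))) rise) ⟩
    expand w (contract (suc w) (frame t π))    ≡⟨ cong (expand w) (trans (sym framed) e') ⟩
    expand w (inflate σ̂ c')                    ≡⟨ expanded ⟩
    inflate σ̂ d                                ∎)
    where open ≡-Reasoning

  step-forward : ∀ π c {π'} → IsPerm (length π) π → IsInflation π c → step t π ≡ just π' →
                 ∃ λ d → IsInflation π' d × suc (sum d) ≡ sum c
  step-forward π c p (lc , e) stepped with step⇒framedStep t π p stepped
  ... | w , rise , framed with contract-inflate-consec c σ̂-perm σ̂-noRise lc (subst (Consec w (suc w)) e rise)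
  ...   | d , ld , sum-d , contracted = d , (trans ld lc , trans framed (trans (cong (contract (suc w)) e) contracted)) , sum-d

  -- An inflation of σ̂ that admits no step is σ itself: a block of size at
  -- least two would give the frame of π an adjacency.
  stuck⇒σ : ∀ π c → IsInflation π c → step t π ≡ nothing → π ≡ σ
  stuck⇒σ π c (lc , e) stuck with sum c ≟ 0
  ... | yes s0 = inflation-trivial e s0
  ... | no s≢0 with sum≢0⇒positive-entry c s≢0
  ...   | u , u<c , c!u>0 = ⊥-elim (consec-frame⇒step t π (inflation-nonempty e) (subst (Consec _ _) (sym e) rise) stuck)
    where
    u∈σ̂ : u ∈ σ̂
    u∈σ̂ = perm-covers K σ̂ (proj₁ (proj₂ σ̂-perm)) (proj₂ (proj₂ σ̂-perm)) (proj₁ σ̂-perm) u (subst (u <_) lc u<c)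
    rise : Consec (offset c u) (suc (offset c u)) (inflate σ̂ c)
    rise = consec-inflate-block σ̂ c u u∈σ̂ c!u>0

  reduces⇒inflation : ∀ f π → IsPerm (length π) π → iter t f π ≡ σ → ∃ (IsInflation π)
  reduces⇒inflation zero π p refl = σ-isInflation
  reduces⇒inflation (suc f) π p reduced with step t π in stepped
  ... | nothing rewrite reduced = σ-isInflation
  ... | just π' = step-backward π p stepped (reduces⇒inflation f π' (step-perm t π p stepped) reduced)

  inflation⇒reduces : ∀ f π c → IsPerm (length π) π → IsInflation π c → sum c ≤ f → iter t f π ≡ σ
  inflation⇒reduces zero π c p (_ , e) s≤0 = inflation-trivial e (NP.n≤0⇒n≡0 s≤0)
  inflation⇒reduces (suc f) π c p infl s≤ with step t π in stepped
  ... | nothing = stuck⇒σ π c infl stepped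
  ... | just π' with step-forward π c p infl stepped
  ...   | d , infl' , sum-d =
    inflation⇒reduces f π' d (step-perm t π p stepped) infl' (NP.≤-pred (subst (_≤ suc f) (sym sum-d) s≤))

  -- Counting: c ↦ unframe t (inflate σ̂ c) is a bijection from the
  -- compositions of N = framedLength t n into K parts onto the fibre of σ.
  fromComposition : List ℕ → List ℕ
  fromComposition c = unframe t (inflate σ̂ c)

  frame-fromComposition : ∀ c → frame t (fromComposition c) ≡ inflate σ̂ c
  frame-fromComposition c = frame-unframe-inflate (countsFirst t) (countsLast t) c σ-perm

  module Count (n : ℕ) where

    N : ℕ
    N = framedLength t n

    reducesToσ? : ∀ π → Dec (reduce t π ≡ σ)
    reducesToσ? π = LP.≡-dec _≟_ (reduce t π) σ

    fibre : List (List ℕ)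
    fibre = filter reducesToσ? (P n)

    fibre⊆image : ∀ {π} → π ∈ fibre → π ∈ map fromComposition (compositions K N)
    fibre⊆image {π} π∈ with ∈-filter⁻ reducesToσ? {xs = P n} π∈
    ... | π∈P , reduced with P-∈⁻ π∈P
    ...   | π-perm@(lπ , _) with reduces⇒inflation (length π) π (subst (λ z → IsPerm z π) (sym lπ) π-perm) reduced
    ...     | c , lc , e = subst (_∈ map fromComposition (compositions K N)) π≡ (∈-map⁺ fromComposition c∈)
      where
      total : K + sum c ≡ N
      total = trans (sym (length-inflate-σ̂ c lc)) (trans (cong length (sym e)) (trans (length-frame t π) (cong (framedLength t) lπ)))
      c∈ : c ∈ compositions K N
      c∈ = compositions-∈⁺ lc total
      π≡ : fromComposition c ≡ π
      π≡ = trans (cong (unframe t) (sym e)) (unframe-frame t π)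

    image⊆fibre : ∀ {π} → π ∈ map fromComposition (compositions K N) → π ∈ fibre
    image⊆fibre π∈ with ∈-map⁻ fromComposition π∈
    ... | c , c∈ , refl with compositions-∈⁻ c∈
    ...   | lc , total = ∈-filter⁺ reducesToσ? (P-∈⁺ π-perm)
                           (inflation⇒reduces (length π) π c π-perm' (lc , frame-fromComposition c) excess)
      where
      π : List ℕ
      π = fromComposition c
      π-perm : IsPerm n π
      π-perm = frame-perm⁻ t (subst₂ IsPerm (trans (sym (length-inflate-perm c σ̂-perm)) (trans (length-inflate-σ̂ c lc) total))
                                           (sym (frame-fromComposition c)) (inflate-perm c σ̂-perm))
      π-perm' : IsPerm (length π) π
      π-perm' = subst (λ z → IsPerm z π) (sym (proj₁ π-perm)) π-perm
      excess : sum c ≤ length π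
      excess = subst (sum c ≤_) (sym (proj₁ π-perm)) (framedLength-excess t total)

    count : countRed t n σ ≡ length (compositions K N)
    count = trans (same-elements⇒length unique-fibre unique-image fibre⊆image image⊆fibre)
                  (LP.length-map fromComposition (compositions K N))
      where
      unique-fibre : Unique fibre
      unique-fibre = UP.filter⁺ reducesToσ? (unique-P n)
      unique-image : Unique (map fromComposition (compositions K N))
      unique-image = unique-map-injectiveOn fromComposition (compositions K N) (unique-compositions K N)
        (λ {c} {d} c∈ d∈ same → inflate-injective c d σ̂-perm σ̂-noRise (proj₁ (compositions-∈⁻ c∈)) (proj₁ (compositions-∈⁻ d∈))
           (trans (sym (frame-fromComposition c)) (trans (cong (frame t) same) (frame-fromComposition d))))

theorem4 : (t : AdjType) (k n : ℕ) → 1 ≤ k → k ≤ n →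
           (σ τ : List ℕ) →
           IsPerm k σ → adj t σ ≡ 0 →
           IsPerm k τ → adj t τ ≡ 0 →
           countRed t n σ ≡ countRed t n τ
theorem4 t k n k≥1 _ σ τ σ-perm σ-irr τ-perm τ-irr =
  trans (Fibre.Count.count t σ-perm σ-irr k≥1 n) (sym (Fibre.Count.count t τ-perm τ-irr k≥1 n))
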